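{- Let $Y=\{z_k:k\in\mathbb{Z}\}$ and let $\mathcal{H}=\mathbb{Q}\langle Y\rangle$ be the quasi-shuffle Hopf algebra (quasi-shuffle product $\ast$, deconcatenation coproduct). Let $N$ be the linear span of the non-singular words and let $\mathcal{N}$ be the two-sided ideal of $(\mathcal{H},\ast)$ generated by $N$. Then: (a) $\mathcal{N}$ is a Hopf ideal of $\mathcal{H}$; (b) for any commutative unital $\mathbb{Q}$-algebra $\mathcal{A}$, the group $T_{\mathcal{A}}:=\{\phi:(\mathcal{H},\ast)\to\mathcal{A}\text{ unital algebra morphism}:\ \phi|_N=0\}$, with the convolution product, is isomorphic to the group of $\mathcal{A}$-valued characters of the Hopf algebra $\mathcal{H}/\mathcal{N}$.
   Context: The quasi-shuffle product: $\mathbf{1}\ast v=v\ast\mathbf{1}=v$, $z_mv\ast z_nw=z_m(v\ast z_nw)+z_n(z_mv\ast w)+z_{m+n}(v\ast w)$. Coproduct: $\Delta(w)=\sum_{uv=w}u\otimes v$; counit $\varepsilon(\mathbf{1})=1$, $\varepsilon(w)=0$ for nonempty $w$. Convolution: $\phi\star\psi=m_{\mathcal{A}}\circ(\phi\otimes\psi)\circ\Delta$. A word $z_{k_1}\cdots z_{k_n}$ is non-singular if $k_1\neq1$, $k_1+k_2\notin\{2,1,0,-2,-4,\ldots\}$ and $k_1+\cdots+k_j\notin\mathbb{Z}_{\le j}$ for $3\le j\le n$. A character is a unital algebra morphism. -}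

module Defs where

open import Level using (Level; _⊔_)
open import Data.Nat using (ℕ; suc) renaming (_*_ to _*ℕ_)
open import Data.Integer as ℤ using (ℤ; +_; _>_) renaming (_+_ to _+ℤ_; -_ to -ℤ_)
open import Data.Rational as ℚ using (ℚ; 0ℚ; 1ℚ) renaming (_+_ to _+ℚ_; _*_ to _*ℚ_; -_ to -ℚ_)
open import Data.List using (List; []; _∷_; [_]; _++_; map; concatMap; foldr)
open import Data.List.Properties using (≡-dec)
open import Data.List.Relation.Unary.All using (All)
open import Data.Product using (Σ; _×_; _,_; proj₁; proj₂)
open import Data.Sum using (_⊎_; inj₁; inj₂)
open import Data.Unit using (⊤)
open import Data.Empty using (⊥)
open import Relation.Nullary using (¬_; yes; no)
open import Relation.Binary.PropositionalEquality using (_≡_; _≢_)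
open import Algebra.Bundles using (CommutativeRing)

-- Words over the alphabet Y = { z_k : k ∈ ℤ }; the letter z_k is k.

Word : Set
Word = List ℤ

-- Elements of H = ℚ⟨Y⟩ are represented by finite formal ℚ-linear
-- combinations of words; equality in H is equality of all coefficients.
Lin : Set
Lin = List (ℚ × Word)

coeff : Lin → Word → ℚ
coeff []             w = 0ℚ
coeff ((q , u) ∷ x)  w with ≡-dec ℤ._≟_ u w
... | yes _ = q +ℚ coeff x w
... | no  _ = coeff x w

infix 4 _≋_
_≋_ : Lin → Lin → Set
x ≋ y = ∀ w → coeff x w ≡ coeff y w

⟪_⟫ : Word → Lin
⟪ w ⟫ = [ (1ℚ , w) ]

𝟙 : Lin
𝟙 = ⟪ [] ⟫

scale : ℚ → Lin → Lin
scale q = map (λ t → (q *ℚ proj₁ t , proj₂ t))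

neg : Lin → Lin
neg = scale (-ℚ 1ℚ)

-- (addition in H is _++_, zero is [])

qsh : Word → Word → List Word
qsh []      w       = [ w ]
qsh (m ∷ v) []      = [ m ∷ v ]
qsh (m ∷ v) (n ∷ w) =
  map (m ∷_) (qsh v (n ∷ w)) ++
  (map (n ∷_) (qsh (m ∷ v) w) ++
   map ((m +ℤ n) ∷_) (qsh v w))

infixl 7 _∗_
_∗_ : Lin → Lin → Lin
x ∗ y = concatMap (λ s → concatMap (λ t →
          map (λ w → (proj₁ s *ℚ proj₁ t , w)) (qsh (proj₂ s) (proj₂ t))) y) x

deconc : Word → List (Word × Word)
deconc []      = ([] , []) ∷ []
deconc (a ∷ w) = ([] , a ∷ w) ∷ map (λ p → (a ∷ proj₁ p , proj₂ p)) (deconc w)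

-- elements of H ⊗ H: formal ℚ-linear combinations of pairs of words
Lin2 : Set
Lin2 = List (ℚ × Word × Word)

coeff2 : Lin2 → Word → Word → ℚ
coeff2 []                 u v = 0ℚ
coeff2 ((q , a , b) ∷ z)  u v with ≡-dec ℤ._≟_ a u | ≡-dec ℤ._≟_ b v
... | yes _ | yes _ = q +ℚ coeff2 z u v
... | _     | _     = coeff2 z u v

infix 4 _≋₂_
_≋₂_ : Lin2 → Lin2 → Set
z ≋₂ z' = ∀ u v → coeff2 z u v ≡ coeff2 z' u v

_⊗_ : Lin → Lin → Lin2
x ⊗ y = concatMap (λ s → map (λ t → (proj₁ s *ℚ proj₁ t , proj₂ s , proj₂ t)) y) x

Δ : Lin → Lin2
Δ = concatMap (λ s → map (λ p → (proj₁ s , proj₁ p , proj₂ p)) (deconc (proj₂ s)))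

ε : Lin → ℚ
ε x = coeff x []

-- Non-singular words  z_{k1} ⋯ z_{kn}  (n ≥ 1):
--   k1 ≠ 1,  k1+k2 ∉ {2,1,0,-2,-4,…},  k1+⋯+kj ∉ ℤ_{≤ j} (3 ≤ j ≤ n)

Bad2 : ℤ → Set
Bad2 s = s ≡ + 2 ⊎ (s ≡ + 1 ⊎ Σ ℕ (λ m → s ≡ -ℤ (+ (2 *ℕ m))))

-- partial-sum condition from index j on; s = k1+⋯+k_{j-1}
PartialOK : ℕ → ℤ → Word → Set
PartialOK j s []      = ⊤
PartialOK j s (k ∷ w) = (s +ℤ k) > + j × PartialOK (suc j) (s +ℤ k) w

NonSingular : Word → Set
NonSingular []             = ⊥
NonSingular (k₁ ∷ [])      = k₁ ≢ + 1
NonSingular (k₁ ∷ k₂ ∷ w)  = k₁ ≢ + 1 × (¬ Bad2 (k₁ +ℤ k₂) × PartialOK 3 (k₁ +ℤ k₂) w)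

InN : Lin → Set
InN x = Σ Lin (λ L → All (λ t → NonSingular (proj₂ t)) L × x ≋ L)

-- 𝒩 = two-sided ideal of (H, ∗) generated by N:
-- the elements  Σ_i a_i ∗ n_i ∗ b_i  with a_i, b_i ∈ H, n_i ∈ N
idealSum : List (Lin × Lin × Lin) → Lin
idealSum = concatMap (λ t → (proj₁ t ∗ proj₁ (proj₂ t)) ∗ proj₂ (proj₂ t))

Inℐ : Lin → Set
Inℐ x = Σ (List (Lin × Lin × Lin))
          (λ L → All (λ t → InN (proj₁ (proj₂ t))) L × x ≋ idealSum L)

In-I⊗H+H⊗I : (Lin → Set) → Lin2 → Set
In-I⊗H+H⊗I I z =
  Σ (List ((Lin × Lin) ⊎ (Lin × Lin)))
    (λ L → All ok L × z ≋₂ concatMap term L)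
  where
  ok : (Lin × Lin) ⊎ (Lin × Lin) → Set
  ok (inj₁ (a , h)) = I a
  ok (inj₂ (h , a)) = I a
  term : (Lin × Lin) ⊎ (Lin × Lin) → Lin2
  term (inj₁ (a , h)) = a ⊗ h
  term (inj₂ (h , a)) = h ⊗ a

IsAntipode : (Word → Lin) → Set
IsAntipode S =
  ∀ w → (concatMap (λ p → S (proj₁ p) ∗ ⟪ proj₂ p ⟫) (deconc w) ≋ scale (ε ⟪ w ⟫) 𝟙)
      × (concatMap (λ p → ⟪ proj₁ p ⟫ ∗ S (proj₂ p)) (deconc w) ≋ scale (ε ⟪ w ⟫) 𝟙)

linExt : (Word → Lin) → Lin → Lin
linExt S = concatMap (λ s → scale (proj₁ s) (S (proj₂ s)))

record IsHopfIdeal (I : Lin → Set) : Set where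
  field
    respects-≋ : ∀ {x y} → x ≋ y → I x → I y
    zero-mem   : I []
    +-closed   : ∀ {x y} → I x → I y → I (x ++ y)
    scale-closed : ∀ q {x} → I x → I (scale q x)
    ∗-closedˡ  : ∀ h {x} → I x → I (h ∗ x)
    ∗-closedʳ  : ∀ h {x} → I x → I (x ∗ h)
    Δ-closed   : ∀ {x} → I x → In-I⊗H+H⊗I I (Δ x)
    ε-vanishes : ∀ {x} → I x → ε x ≡ 0ℚ
    S-closed   : ∀ S → IsAntipode S → ∀ {x} → I x → I (linExt S x)

-- Characters with values in a commutative unital ℚ-algebra A
-- (A a commutative ring, ι : ℚ → A the structure map, a unital ring hom).

module Characters {c ℓ : Level} (A : CommutativeRing c ℓ)
                  (ι : ℚ → CommutativeRing.Carrier A) where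
  open CommutativeRing A

  -- a ℚ-linear map H → A is determined by its values on words
  lin : (Word → Carrier) → Lin → Carrier
  lin φ = foldr (λ t acc → ι (proj₁ t) * φ (proj₂ t) + acc) 0#

  IsCharacter : (Word → Carrier) → Set ℓ
  IsCharacter φ = lin φ 𝟙 ≈ 1# × (∀ x y → lin φ (x ∗ y) ≈ lin φ x * lin φ y)

  InT : (Word → Carrier) → Set ℓ
  InT φ = IsCharacter φ × (∀ x → InN x → lin φ x ≈ 0#)

  _⋆_ : (Word → Carrier) → (Word → Carrier) → (Word → Carrier)
  (φ ⋆ ψ) w = foldr (λ p acc → φ (proj₁ p) * ψ (proj₂ p) + acc) 0# (deconc w)

  e : Word → Carrier
  e []      = 1#
  e (_ ∷ _) = 0#

  infix 4 _≐_
  _≐_ : (Word → Carrier) → (Word → Carrier) → Set ℓ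
  φ ≐ ψ = ∀ w → φ w ≈ ψ w

  -- The quotient Hopf algebra H/𝒩: carrier H, with x ~ y iff x - y ∈ 𝒩.
  -- A map H/𝒩 → A is a map χ : H → A constant on ~-classes.
  IsQuotCharacter : (Lin → Carrier) → Set ℓ
  IsQuotCharacter χ =
      (∀ x y → Inℐ (x ++ neg y) → χ x ≈ χ y)
    × ((∀ x y → χ (x ++ y) ≈ χ x + χ y)
    × ((∀ q x → χ (scale q x) ≈ ι q * χ x)
    × (χ 𝟙 ≈ 1#
    × (∀ x y → χ (x ∗ y) ≈ χ x * χ y))))

  -- convolution in the character group of H/𝒩, using the induced
  -- coproduct  Δ̄(x̄) = Σ ū ⊗ v̄  (computed on representatives)
  _⋆̄_ : (Lin → Carrier) → (Lin → Carrier) → (Lin → Carrier)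
  (χ ⋆̄ κ) x = foldr (λ t acc → ι (proj₁ t) * (χ ⟪ proj₁ (proj₂ t) ⟫ * κ ⟪ proj₂ (proj₂ t) ⟫) + acc)
                    0# (Δ x)

  infix 4 _≐̄_
  _≐̄_ : (Lin → Carrier) → (Lin → Carrier) → Set ℓ
  χ ≐̄ κ = ∀ x → χ x ≈ κ x

  TGroupIsoQuotChars : Set (c ⊔ ℓ)
  TGroupIsoQuotChars =
      ( InT e
      × ((∀ φ ψ → InT φ → InT ψ → InT (φ ⋆ ψ))
      × (∀ φ → InT φ → Σ (Word → Carrier) (λ ψ → InT ψ × ((φ ⋆ ψ) ≐ e × (ψ ⋆ φ) ≐ e)))))
    × Σ ((Word → Carrier) → (Lin → Carrier)) (λ Φ →
      Σ ((Lin → Carrier) → (Word → Carrier)) (λ Ψ →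
          (∀ φ → InT φ → IsQuotCharacter (Φ φ))
        × ((∀ χ → IsQuotCharacter χ → InT (Ψ χ))
        × ((∀ φ φ' → InT φ → InT φ' → φ ≐ φ' → Φ φ ≐̄ Φ φ')
        × ((∀ χ χ' → IsQuotCharacter χ → IsQuotCharacter χ' → χ ≐̄ χ' → Ψ χ ≐ Ψ χ')
        × ((∀ φ → InT φ → Ψ (Φ φ) ≐ φ)
        × ((∀ χ → IsQuotCharacter χ → Φ (Ψ χ) ≐̄ χ)
        × (∀ φ ψ → InT φ → InT ψ → Φ (φ ⋆ ψ) ≐̄ (Φ φ ⋆̄ Φ ψ)))))))))

{-# OPTIONS --safe #-}
module Submission where

-- (a) 𝒩 is an ideal by construction, and ε vanishes on it because ε is multiplicative and kills
-- nonempty words. Every nonempty prefix of a non-singular word is non-singular, so each term u ⊗ v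
-- of Δ n (n non-singular) has u ∈ N or u = 1, v = n; since Δ is multiplicative, Δ 𝒩 ⊆ 𝒩 ⊗ H + H ⊗ 𝒩.
-- An antipode S is antimultiplicative (S (x ∗ y) and S y ∗ S x are both right convolution inverses
-- of the product map), and S n = − Σ_{uv = n, u ≠ 1} u ∗ S v ∈ 𝒩 for n non-singular, so S 𝒩 ⊆ 𝒩.
-- (b) A character vanishes on N iff it vanishes on 𝒩, i.e. iff it factors through H/𝒩; linear
-- extension and restriction to words are inverse to each other and turn ⋆ into the convolution
-- of H/𝒩. T_A is closed under ⋆ by the same prefix argument, and φ ∘ S inverts φ for the antipode
-- S built by the recursion above.

open import Defs
open import Level using (Level; 0ℓ)
open import Data.Nat using (ℕ; zero; suc; _<_; _≤_; s≤s; z≤n) renaming (_+_ to _+ℕ_)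
import Data.Nat.Properties as ℕP
open import Data.Nat.Properties using (≤-trans; n≤1+n)
open import Data.Integer as ℤ using (ℤ) renaming (_+_ to _+ℤ_)
import Data.Integer.Properties as ℤP
open import Data.Rational as ℚ using (ℚ; 0ℚ; 1ℚ) renaming (_+_ to _+ℚ_; _*_ to _*ℚ_; -_ to -ℚ_)
import Data.Rational.Properties as ℚP
open import Data.Rational.Base using (+-*-rawRing)
open import Data.List using (List; []; _∷_; [_]; _++_; map; foldr; length; concatMap)
import Data.List.Properties as LP
open import Data.List.Properties using (≡-dec)
open import Data.List.Relation.Unary.All as All using (All; []; _∷_)
open import Data.List.Relation.Unary.All.Properties using (gmap⁺; ++⁺)
open import Data.Maybe using (Maybe; just; nothing)
open import Data.Product using (Σ; _×_; _,_; proj₁; proj₂)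
import Data.Product.Properties as ×P
open import Data.Sum using (_⊎_; inj₁; inj₂)
open import Data.Unit using (tt)
open import Data.Empty using (⊥-elim)
open import Relation.Nullary using (yes; no)
open import Relation.Binary.Bundles using (Setoid)
open import Relation.Binary.Definitions using (DecidableEquality)
open import Relation.Binary.PropositionalEquality as Eq using (_≡_; _≢_; refl; cong; cong₂; sym; trans; subst)
open import Algebra.Bundles using (CommutativeRing)
open import Algebra.Morphism.Structures using (module RingMorphisms)
import Algebra.Properties.Ring as RingProps
import Algebra.Morphism.Construct.Identity as Identity
open import Tactic.RingSolver
open import Tactic.RingSolver.Core.AlmostCommutativeRing using (AlmostCommutativeRing; fromCommutativeRing)

module LinearForm {c ℓ : Level} (R : CommutativeRing c ℓ) (ι : ℚ → CommutativeRing.Carrier R)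
                  (ι-hom : RingMorphisms.IsRingHomomorphism +-*-rawRing (CommutativeRing.rawRing R) ι)
                  (K : Set) (_≟K_ : DecidableEquality K)
                  (cf : List (ℚ × K) → K → ℚ)
                  (cf-[] : ∀ k → cf [] k ≡ 0ℚ)
                  (cf-yes : ∀ q k z → cf ((q , k) ∷ z) k ≡ q +ℚ cf z k)
                  (cf-no : ∀ q k k' z → k ≢ k' → cf ((q , k) ∷ z) k' ≡ cf z k')
                  where
  open CommutativeRing R renaming (refl to ≈-refl; sym to ≈-sym; trans to ≈-trans)
  open RingMorphisms.IsRingHomomorphism ι-hom using (+-homo; 0#-homo)
  open import Algebra.Properties.CommutativeSemigroup +-commutativeSemigroup using (x∙yz≈y∙xz)
  open import Relation.Binary.Reasoning.Setoid setoid

  evalLin : (K → Carrier) → List (ℚ × K) → Carrier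
  evalLin F = foldr (λ t acc → ι (proj₁ t) * F (proj₂ t) + acc) 0#

  evalLin-++ : ∀ F z z' → evalLin F (z ++ z') ≈ evalLin F z + evalLin F z'
  evalLin-++ F [] z' = ≈-sym (+-identityˡ _)
  evalLin-++ F (t ∷ z) z' = ≈-trans (+-congˡ (evalLin-++ F z z')) (≈-sym (+-assoc _ _ _))

  dropKey : K → List (ℚ × K) → List (ℚ × K)
  dropKey k [] = []
  dropKey k ((q , k') ∷ z) with k' ≟K k
  ... | yes _ = dropKey k z
  ... | no _ = (q , k') ∷ dropKey k z

  length-dropKey : ∀ k z → length (dropKey k z) ≤ length z
  length-dropKey k [] = z≤n
  length-dropKey k ((q , k') ∷ z) with k' ≟K k
  ... | yes _ = ≤-trans (length-dropKey k z) (n≤1+n _)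
  ... | no _ = s≤s (length-dropKey k z)

  length-dropKey-head : ∀ q k z → length (dropKey k ((q , k) ∷ z)) ≤ length z
  length-dropKey-head q k z with k ≟K k
  ... | yes _ = length-dropKey k z
  ... | no k≢k = ⊥-elim (k≢k refl)

  cf-dropKey-self : ∀ k z → cf (dropKey k z) k ≡ 0ℚ
  cf-dropKey-self k [] = cf-[] k
  cf-dropKey-self k ((q , k') ∷ z) with k' ≟K k
  ... | yes _ = cf-dropKey-self k z
  ... | no k'≢k = trans (cf-no q k' k (dropKey k z) k'≢k) (cf-dropKey-self k z)

  cf-dropKey-other : ∀ k z k' → k ≢ k' → cf (dropKey k z) k' ≡ cf z k'
  cf-dropKey-other k [] k' _ = refl
  cf-dropKey-other k ((q , k'') ∷ z) k' k≢k' with k'' ≟K k | k'' ≟K k'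
  ... | yes refl | yes refl = ⊥-elim (k≢k' refl)
  ... | yes refl | no k''≢k' = trans (cf-dropKey-other k z k' k≢k') (sym (cf-no q k'' k' z k''≢k'))
  ... | no _ | yes refl = trans (cf-yes q k'' (dropKey k z)) (trans (cong (q +ℚ_) (cf-dropKey-other k z k'' k≢k'))
                           (sym (cf-yes q k'' z)))
  ... | no _ | no k''≢k' = trans (cf-no q k'' k' (dropKey k z) k''≢k') (trans (cf-dropKey-other k z k' k≢k')
                            (sym (cf-no q k'' k' z k''≢k')))

  evalLin-dropKey : ∀ F k z → evalLin F z ≈ ι (cf z k) * F k + evalLin F (dropKey k z)
  evalLin-dropKey F k [] = begin
    0#                 ≈⟨ ≈-sym (+-identityʳ 0#) ⟩
    0# + 0#            ≈⟨ +-congʳ (≈-sym (zeroˡ (F k))) ⟩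
    0# * F k + 0#      ≈⟨ +-congʳ (*-congʳ (≈-sym 0#-homo)) ⟩
    ι 0ℚ * F k + 0#    ≡⟨ cong (λ r → ι r * F k + 0#) (sym (cf-[] k)) ⟩
    ι (cf [] k) * F k + 0# ∎
  evalLin-dropKey F k ((q , k') ∷ z) with k' ≟K k
  ... | yes refl = begin
    ι q * F k + evalLin F z                                   ≈⟨ +-congˡ (evalLin-dropKey F k z) ⟩
    ι q * F k + (ι (cf z k) * F k + evalLin F (dropKey k z))   ≈⟨ ≈-sym (+-assoc _ _ _) ⟩
    (ι q * F k + ι (cf z k) * F k) + evalLin F (dropKey k z)   ≈⟨ +-congʳ (≈-sym (distribʳ (F k) _ _)) ⟩
    (ι q + ι (cf z k)) * F k + evalLin F (dropKey k z)         ≈⟨ +-congʳ (*-congʳ (≈-sym (+-homo q (cf z k)))) ⟩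
    ι (q +ℚ cf z k) * F k + evalLin F (dropKey k z)            ≡⟨ cong (λ r → ι r * F k + evalLin F (dropKey k z)) (sym (cf-yes q k z)) ⟩
    ι (cf ((q , k) ∷ z) k) * F k + evalLin F (dropKey k z)     ∎
  ... | no k'≢k = begin
    ι q * F k' + evalLin F z                                   ≈⟨ +-congˡ (evalLin-dropKey F k z) ⟩
    ι q * F k' + (ι (cf z k) * F k + evalLin F (dropKey k z))  ≈⟨ x∙yz≈y∙xz _ _ _ ⟩
    ι (cf z k) * F k + (ι q * F k' + evalLin F (dropKey k z))  ≡⟨ cong (λ r → ι r * F k + (ι q * F k' + evalLin F (dropKey k z)))
        (sym (cf-no q k' k z k'≢k)) ⟩
    ι (cf ((q , k') ∷ z) k) * F k + (ι q * F k' + evalLin F (dropKey k z)) ∎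

  indicator : K → K → Carrier
  indicator k k' with k' ≟K k
  ... | yes _ = 1#
  ... | no _ = 0#

  evalLin-indicator : ∀ k z → evalLin (indicator k) z ≈ ι (cf z k)
  evalLin-indicator k [] = ≈-sym (≈-trans (reflexive (cong ι (cf-[] k))) 0#-homo)
  evalLin-indicator k ((q , k') ∷ z) with k' ≟K k
  ... | yes refl = begin
    ι q * 1# + evalLin (indicator k) z ≈⟨ +-cong (*-identityʳ (ι q)) (evalLin-indicator k z) ⟩
    ι q + ι (cf z k)                  ≈⟨ ≈-sym (+-homo q (cf z k)) ⟩
    ι (q +ℚ cf z k)                   ≡⟨ cong ι (sym (cf-yes q k z)) ⟩
    ι (cf ((q , k) ∷ z) k)            ∎
  ... | no k'≢k = begin
    ι q * 0# + evalLin (indicator k) z ≈⟨ +-cong (zeroʳ (ι q)) (evalLin-indicator k z) ⟩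
    0# + ι (cf z k)                   ≈⟨ +-identityˡ _ ⟩
    ι (cf z k)                        ≡⟨ cong ι (sym (cf-no q k' k z k'≢k)) ⟩
    ι (cf ((q , k') ∷ z) k)           ∎

  evalLin-cf-cong : ∀ F z z' → (∀ k → cf z k ≡ cf z' k) → evalLin F z ≈ evalLin F z'
  evalLin-cf-cong F z z' = go (length z +ℕ length z') z z' ℕP.≤-refl
    where
    dropKey-cf-cong : ∀ k z z' → (∀ k' → cf z k' ≡ cf z' k') → ∀ k' → cf (dropKey k z) k' ≡ cf (dropKey k z') k'
    dropKey-cf-cong k z z' h k' with k ≟K k'
    ... | yes refl = trans (cf-dropKey-self k z) (sym (cf-dropKey-self k z'))
    ... | no k≢k' = trans (cf-dropKey-other k z k' k≢k') (trans (h k') (sym (cf-dropKey-other k z' k' k≢k')))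

    peel : ∀ k z z' → cf z k ≡ cf z' k → evalLin F (dropKey k z) ≈ evalLin F (dropKey k z') → evalLin F z ≈ evalLin F z'
    peel k z z' hk ih = begin
      evalLin F z                                 ≈⟨ evalLin-dropKey F k z ⟩
      ι (cf z k) * F k + evalLin F (dropKey k z)   ≡⟨ cong (λ r → ι r * F k + evalLin F (dropKey k z)) hk ⟩
      ι (cf z' k) * F k + evalLin F (dropKey k z)  ≈⟨ +-congˡ ih ⟩
      ι (cf z' k) * F k + evalLin F (dropKey k z') ≈⟨ ≈-sym (evalLin-dropKey F k z') ⟩
      evalLin F z' ∎

    go : ∀ n z z' → length z +ℕ length z' ≤ n → (∀ k → cf z k ≡ cf z' k) → evalLin F z ≈ evalLin F z'
    go _ [] [] _ _ = ≈-refl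
    go (suc n) ((q , k) ∷ z) z' (s≤s le) h = peel k _ z' (h k)
      (go n _ _ (≤-trans (ℕP.+-mono-≤ (length-dropKey-head q k z) (length-dropKey k z')) le) (dropKey-cf-cong k _ z' h))
    go (suc n) [] ((q , k) ∷ z') (s≤s le) h = peel k [] _ (h k)
      (go n [] _ (≤-trans (length-dropKey-head q k z') le) (dropKey-cf-cong k [] _ h))

module _ where
  open Eq.≡-Reasoning

  _≟ʷ_ : DecidableEquality Word
  _≟ʷ_ = ≡-dec ℤ._≟_

  _≟ʷʷ_ : DecidableEquality (Word × Word)
  _≟ʷʷ_ = ×P.≡-dec _≟ʷ_ _≟ʷ_

  ∑ : {X : Set} → List X → (X → ℚ) → ℚ
  ∑ [] f = 0ℚ
  ∑ (x ∷ l) f = f x +ℚ ∑ l f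

  module _ {X : Set} where
    ∑-cong : ∀ (l : List X) {f g : X → ℚ} → (∀ x → f x ≡ g x) → ∑ l f ≡ ∑ l g
    ∑-cong [] h = refl
    ∑-cong (x ∷ l) h = cong₂ _+ℚ_ (h x) (∑-cong l h)

    ∑-++ : ∀ (l m : List X) f → ∑ (l ++ m) f ≡ ∑ l f +ℚ ∑ m f
    ∑-++ [] m f = sym (ℚP.+-identityˡ _)
    ∑-++ (x ∷ l) m f = trans (cong (f x +ℚ_) (∑-++ l m f)) (sym (ℚP.+-assoc (f x) (∑ l f) (∑ m f)))

    ∑-+ : ∀ (l : List X) f g → ∑ l (λ x → f x +ℚ g x) ≡ ∑ l f +ℚ ∑ l g
    ∑-+ [] f g = sym (ℚP.+-identityˡ _)
    ∑-+ (x ∷ l) f g = begin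
      (f x +ℚ g x) +ℚ ∑ l (λ x → f x +ℚ g x) ≡⟨ cong ((f x +ℚ g x) +ℚ_) (∑-+ l f g) ⟩
      (f x +ℚ g x) +ℚ (∑ l f +ℚ ∑ l g) ≡⟨ ℚP.+-assoc (f x) (g x) _ ⟩
      f x +ℚ (g x +ℚ (∑ l f +ℚ ∑ l g)) ≡⟨ cong (f x +ℚ_) (sym (ℚP.+-assoc (g x) (∑ l f) (∑ l g))) ⟩
      f x +ℚ ((g x +ℚ ∑ l f) +ℚ ∑ l g) ≡⟨ cong (λ z → f x +ℚ (z +ℚ ∑ l g)) (ℚP.+-comm (g x) (∑ l f)) ⟩
      f x +ℚ ((∑ l f +ℚ g x) +ℚ ∑ l g) ≡⟨ cong (f x +ℚ_) (ℚP.+-assoc (∑ l f) (g x) (∑ l g)) ⟩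
      f x +ℚ (∑ l f +ℚ (g x +ℚ ∑ l g)) ≡⟨ sym (ℚP.+-assoc (f x) _ _) ⟩
      (f x +ℚ ∑ l f) +ℚ (g x +ℚ ∑ l g) ∎

    ∑-*ˡ : ∀ (l : List X) c f → ∑ l (λ x → c *ℚ f x) ≡ c *ℚ ∑ l f
    ∑-*ˡ [] c f = sym (ℚP.*-zeroʳ c)
    ∑-*ˡ (x ∷ l) c f = trans (cong (c *ℚ f x +ℚ_) (∑-*ˡ l c f)) (sym (ℚP.*-distribˡ-+ c (f x) (∑ l f)))

    ∑-zero : ∀ (l : List X) {f} → (∀ x → f x ≡ 0ℚ) → ∑ l f ≡ 0ℚ
    ∑-zero [] h = refl
    ∑-zero (x ∷ l) h = trans (cong₂ _+ℚ_ (h x) (∑-zero l h)) (ℚP.+-identityˡ 0ℚ)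

    ∑-zero-All : ∀ {P : X → Set} {l f} → All P l → (∀ {x} → P x → f x ≡ 0ℚ) → ∑ l f ≡ 0ℚ
    ∑-zero-All [] h = refl
    ∑-zero-All (p ∷ ps) h = trans (cong₂ _+ℚ_ (h p) (∑-zero-All ps h)) (ℚP.+-identityˡ 0ℚ)

  module _ {X Y : Set} where
    ∑-map : ∀ (g : X → Y) (l : List X) f → ∑ (map g l) f ≡ ∑ l (λ x → f (g x))
    ∑-map g [] f = refl
    ∑-map g (x ∷ l) f = cong (f (g x) +ℚ_) (∑-map g l f)

    ∑-concatMap : ∀ (g : X → List Y) (l : List X) f → ∑ (concatMap g l) f ≡ ∑ l (λ x → ∑ (g x) f)
    ∑-concatMap g [] f = refl
    ∑-concatMap g (x ∷ l) f = trans (∑-++ (g x) (concatMap g l) f) (cong (∑ (g x) f +ℚ_) (∑-concatMap g l f))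

    ∑-swap : ∀ (l : List X) (m : List Y) (h : X → Y → ℚ) →
      ∑ l (λ x → ∑ m (λ y → h x y)) ≡ ∑ m (λ y → ∑ l (λ x → h x y))
    ∑-swap [] m h = sym (∑-zero m (λ _ → refl))
    ∑-swap (x ∷ l) m h = trans (cong (∑ m (λ y → h x y) +ℚ_) (∑-swap l m h))
                              (sym (∑-+ m (λ y → h x y) (λ y → ∑ l (λ x → h x y))))

  ⟨_∣_⟩ : Lin → (Word → ℚ) → ℚ
  ⟨ x ∣ F ⟩ = ∑ x (λ t → proj₁ t *ℚ F (proj₂ t))

  ⟨_∣_⟩₂ : Lin2 → (Word → Word → ℚ) → ℚ
  ⟨ z ∣ G ⟩₂ = ∑ z (λ t → proj₁ t *ℚ G (proj₁ (proj₂ t)) (proj₂ (proj₂ t)))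

  -- x ≈ y: equal pairings with every ℚ-valued function on words. Identities in H are proved in this form,
  -- as identities of finite sums of rationals; ≋→≈ and ≈→≋ show that it is coefficientwise equality.
  infix 4 _≈_ _≈₂_
  record _≈_ (x y : Lin) : Set where
    constructor mk≈
    field ≈app : ∀ F → ⟨ x ∣ F ⟩ ≡ ⟨ y ∣ F ⟩
  open _≈_ public

  record _≈₂_ (z z' : Lin2) : Set where
    constructor mk≈₂
    field ≈₂app : ∀ G → ⟨ z ∣ G ⟩₂ ≡ ⟨ z' ∣ G ⟩₂
  open _≈₂_ public

  ≈-refl : ∀ {x} → x ≈ x
  ≈-refl = mk≈ λ F → refl
  ≈-sym : ∀ {x y} → x ≈ y → y ≈ x
  ≈-sym p = mk≈ λ F → sym (≈app p F)
  ≈-trans : ∀ {x y z} → x ≈ y → y ≈ z → x ≈ z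
  ≈-trans p q = mk≈ λ F → trans (≈app p F) (≈app q F)

  ≈₂-sym : ∀ {x y} → x ≈₂ y → y ≈₂ x
  ≈₂-sym p = mk≈₂ λ F → sym (≈₂app p F)
  ≈₂-trans : ∀ {x y z} → x ≈₂ y → y ≈₂ z → x ≈₂ z
  ≈₂-trans p q = mk≈₂ λ F → trans (≈₂app p F) (≈₂app q F)

  coeff-[] : ∀ w → coeff [] w ≡ 0ℚ
  coeff-[] w = refl

  coeff-yes : ∀ q k z → coeff ((q , k) ∷ z) k ≡ q +ℚ coeff z k
  coeff-yes q k z with ≡-dec ℤ._≟_ k k
  ... | yes _ = refl
  ... | no ne = ⊥-elim (ne refl)

  coeff-no : ∀ q k k' z → k ≢ k' → coeff ((q , k) ∷ z) k' ≡ coeff z k'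
  coeff-no q k k' z ne with ≡-dec ℤ._≟_ k k'
  ... | yes eq = ⊥-elim (ne eq)
  ... | no _ = refl

  coeff₂ : Lin2 → Word × Word → ℚ
  coeff₂ z p = coeff2 z (proj₁ p) (proj₂ p)

  coeff₂-yes : ∀ q k z → coeff₂ ((q , k) ∷ z) k ≡ q +ℚ coeff₂ z k
  coeff₂-yes q (a , b) z with ≡-dec ℤ._≟_ a a | ≡-dec ℤ._≟_ b b
  ... | yes _ | yes _ = refl
  ... | no ne | _ = ⊥-elim (ne refl)
  ... | yes _ | no ne = ⊥-elim (ne refl)

  coeff₂-no : ∀ q k k' z → k ≢ k' → coeff₂ ((q , k) ∷ z) k' ≡ coeff₂ z k'
  coeff₂-no q (a , b) (u , v) z ne with ≡-dec ℤ._≟_ a u | ≡-dec ℤ._≟_ b v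
  ... | yes refl | yes refl = ⊥-elim (ne refl)
  ... | no _ | _ = refl
  ... | yes _ | no _ = refl

  module Evalℚ = LinearForm ℚP.+-*-commutativeRing (λ q → q) (Identity.isRingHomomorphism +-*-rawRing refl)

  module Evalℚ¹ = Evalℚ Word _≟ʷ_ coeff coeff-[] coeff-yes coeff-no
  module Evalℚ² = Evalℚ (Word × Word) _≟ʷʷ_ coeff₂ (λ _ → refl) coeff₂-yes coeff₂-no

  evalLin-pairing : ∀ F x → Evalℚ¹.evalLin F x ≡ ⟨ x ∣ F ⟩
  evalLin-pairing F [] = refl
  evalLin-pairing F (t ∷ x) = cong (proj₁ t *ℚ F (proj₂ t) +ℚ_) (evalLin-pairing F x)

  evalLin-pairing₂ : ∀ G z → Evalℚ².evalLin (λ p → G (proj₁ p) (proj₂ p)) z ≡ ⟨ z ∣ G ⟩₂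
  evalLin-pairing₂ G [] = refl
  evalLin-pairing₂ G (t ∷ z) = cong (proj₁ t *ℚ G (proj₁ (proj₂ t)) (proj₂ (proj₂ t)) +ℚ_) (evalLin-pairing₂ G z)

  ≋→≈ : ∀ {x y} → x ≋ y → x ≈ y
  ≋→≈ {x} {y} h = mk≈ λ F → trans (sym (evalLin-pairing F x)) (trans (Evalℚ¹.evalLin-cf-cong F x y h) (evalLin-pairing F y))

  ≋₂→≈₂ : ∀ {x y} → x ≋₂ y → x ≈₂ y
  ≋₂→≈₂ {x} {y} h = mk≈₂ λ G → trans (sym (evalLin-pairing₂ G x))
    (trans (Evalℚ².evalLin-cf-cong (λ p → G (proj₁ p) (proj₂ p)) x y (λ k → h (proj₁ k) (proj₂ k))) (evalLin-pairing₂ G y))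

  ≈→≋ : ∀ {x y} → x ≈ y → x ≋ y
  ≈→≋ {x} {y} h w = trans (pair-indicator x) (trans (≈app h (Evalℚ¹.indicator w)) (sym (pair-indicator y)))
    where
    pair-indicator : ∀ x → coeff x w ≡ ⟨ x ∣ Evalℚ¹.indicator w ⟩
    pair-indicator x = trans (sym (Evalℚ¹.evalLin-indicator w x)) (evalLin-pairing _ x)

  ≈₂→≋₂ : ∀ {x y} → x ≈₂ y → x ≋₂ y
  ≈₂→≋₂ {x} {y} h a b = trans (pair-indicator x) (trans (≈₂app h (λ u v → Evalℚ².indicator (a , b) (u , v))) (sym (pair-indicator y)))
    where
    pair-indicator : ∀ x → coeff2 x a b ≡ ⟨ x ∣ (λ u v → Evalℚ².indicator (a , b) (u , v)) ⟩₂
    pair-indicator x = trans (sym (Evalℚ².evalLin-indicator (a , b) x)) (evalLin-pairing₂ _ x)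

  ∑⧢ : Word → Word → (Word → ℚ) → ℚ
  ∑⧢ u v F = ∑ (qsh u v) F

  ∑Δ : Word → (Word → Word → ℚ) → ℚ
  ∑Δ [] G = G [] [] +ℚ 0ℚ
  ∑Δ (a ∷ w) G = G [] (a ∷ w) +ℚ ∑Δ w (λ p s → G (a ∷ p) s)

  ∑-deconc : ∀ w G → ∑ (deconc w) (λ p → G (proj₁ p) (proj₂ p)) ≡ ∑Δ w G
  ∑-deconc [] G = refl
  ∑-deconc (a ∷ w) G = cong (G [] (a ∷ w) +ℚ_) (trans (∑-map _ (deconc w) _) (∑-deconc w (λ p s → G (a ∷ p) s)))

  pair-++ : ∀ x y F → ⟨ x ++ y ∣ F ⟩ ≡ ⟨ x ∣ F ⟩ +ℚ ⟨ y ∣ F ⟩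
  pair-++ x y F = ∑-++ x y _

  pair-cong : ∀ x {F G} → (∀ u → F u ≡ G u) → ⟨ x ∣ F ⟩ ≡ ⟨ x ∣ G ⟩
  pair-cong x h = ∑-cong x (λ t → cong (proj₁ t *ℚ_) (h (proj₂ t)))

  pair-scale : ∀ q x F → ⟨ scale q x ∣ F ⟩ ≡ q *ℚ ⟨ x ∣ F ⟩
  pair-scale q x F = trans (∑-map _ x _)
    (trans (∑-cong x (λ t → ℚP.*-assoc q (proj₁ t) (F (proj₂ t)))) (∑-*ˡ x q _))

  pair-⟪⟫ : ∀ w F → ⟨ ⟪ w ⟫ ∣ F ⟩ ≡ F w
  pair-⟪⟫ w F = trans (ℚP.+-identityʳ (1ℚ *ℚ F w)) (ℚP.*-identityˡ (F w))

  pair-concatMap : ∀ {X : Set} (f : X → Lin) l F → ⟨ concatMap f l ∣ F ⟩ ≡ ∑ l (λ t → ⟨ f t ∣ F ⟩)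
  pair-concatMap f l F = ∑-concatMap f l _

  pair-* : ∀ x c F → ⟨ x ∣ (λ u → c *ℚ F u) ⟩ ≡ c *ℚ ⟨ x ∣ F ⟩
  pair-* x c F = trans (∑-cong x (λ t → trans (sym (ℚP.*-assoc (proj₁ t) c (F (proj₂ t))))
    (trans (cong (_*ℚ F (proj₂ t)) (ℚP.*-comm (proj₁ t) c)) (ℚP.*-assoc c (proj₁ t) (F (proj₂ t)))))) (∑-*ˡ x c _)

  pair-∑ : ∀ {X : Set} x (l : List X) (H : X → Word → ℚ) →
    ⟨ x ∣ (λ u → ∑ l (λ t → H t u)) ⟩ ≡ ∑ l (λ t → ⟨ x ∣ H t ⟩)
  pair-∑ x l H = trans (∑-cong x (λ s → sym (∑-*ˡ l (proj₁ s) (λ t → H t (proj₂ s)))))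
    (∑-swap x l (λ s t → proj₁ s *ℚ H t (proj₂ s)))

  pair-swap : ∀ x y (H : Word → Word → ℚ) →
    ⟨ x ∣ (λ u → ⟨ y ∣ (λ v → H u v) ⟩) ⟩ ≡ ⟨ y ∣ (λ v → ⟨ x ∣ (λ u → H u v) ⟩) ⟩
  pair-swap x y H = trans (pair-∑ x y (λ t u → proj₁ t *ℚ H u (proj₂ t)))
    (∑-cong y (λ t → pair-* x (proj₁ t) (λ u → H u (proj₂ t))))

  pair-neg : ∀ x F → ⟨ neg x ∣ F ⟩ ≡ -ℚ ⟨ x ∣ F ⟩
  pair-neg x F = trans (pair-scale (-ℚ 1ℚ) x F) (trans (sym (ℚP.neg-distribˡ-* 1ℚ ⟨ x ∣ F ⟩)) (cong -ℚ_ (ℚP.*-identityˡ ⟨ x ∣ F ⟩)))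

  pair-map-const : ∀ c (l : List Word) F → ⟨ map (λ w → (c , w)) l ∣ F ⟩ ≡ c *ℚ ∑ l F
  pair-map-const c l F = trans (∑-map _ l _) (∑-*ˡ l c F)

  pair-∗ : ∀ x y F → ⟨ x ∗ y ∣ F ⟩ ≡ ⟨ x ∣ (λ u → ⟨ y ∣ (λ v → ∑⧢ u v F) ⟩) ⟩
  pair-∗ x y F = begin
    ⟨ x ∗ y ∣ F ⟩ ≡⟨ pair-concatMap _ x F ⟩
    ∑ x (λ s → ⟨ concatMap (λ t → map (λ w → (proj₁ s *ℚ proj₁ t , w)) (qsh (proj₂ s) (proj₂ t))) y ∣ F ⟩)
      ≡⟨ ∑-cong x (λ s → pair-concatMap _ y F) ⟩
    ∑ x (λ s → ∑ y (λ t → ⟨ map (λ w → (proj₁ s *ℚ proj₁ t , w)) (qsh (proj₂ s) (proj₂ t)) ∣ F ⟩))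
      ≡⟨ ∑-cong x (λ s → ∑-cong y (λ t → trans (pair-map-const _ (qsh (proj₂ s) (proj₂ t)) F)
           (ℚP.*-assoc (proj₁ s) (proj₁ t) _))) ⟩
    ∑ x (λ s → ∑ y (λ t → proj₁ s *ℚ (proj₁ t *ℚ ∑⧢ (proj₂ s) (proj₂ t) F)))
      ≡⟨ ∑-cong x (λ s → ∑-*ˡ y (proj₁ s) _) ⟩
    ⟨ x ∣ (λ u → ⟨ y ∣ (λ v → ∑⧢ u v F) ⟩) ⟩ ∎

  pair-linExt : ∀ S x F → ⟨ linExt S x ∣ F ⟩ ≡ ⟨ x ∣ (λ u → ⟨ S u ∣ F ⟩) ⟩
  pair-linExt S x F = trans (pair-concatMap _ x F) (∑-cong x (λ s → pair-scale (proj₁ s) (S (proj₂ s)) F))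

  pair₂-++ : ∀ x y G → ⟨ x ++ y ∣ G ⟩₂ ≡ ⟨ x ∣ G ⟩₂ +ℚ ⟨ y ∣ G ⟩₂
  pair₂-++ x y G = ∑-++ x y _

  pair₂-concatMap : ∀ {X : Set} (f : X → Lin2) l G → ⟨ concatMap f l ∣ G ⟩₂ ≡ ∑ l (λ t → ⟨ f t ∣ G ⟩₂)
  pair₂-concatMap f l G = ∑-concatMap f l _

  pair₂-⊗ : ∀ x y G → ⟨ x ⊗ y ∣ G ⟩₂ ≡ ⟨ x ∣ (λ u → ⟨ y ∣ (λ v → G u v) ⟩) ⟩
  pair₂-⊗ x y G = trans (pair₂-concatMap _ x G) (∑-cong x (λ s → trans (∑-map _ y _)
    (trans (∑-cong y (λ t → ℚP.*-assoc (proj₁ s) (proj₁ t) _)) (∑-*ˡ y (proj₁ s) _))))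

  pair₂-Δ : ∀ x G → ⟨ Δ x ∣ G ⟩₂ ≡ ⟨ x ∣ (λ w → ∑Δ w G) ⟩
  pair₂-Δ x G = trans (pair₂-concatMap _ x G) (∑-cong x (λ s → trans (∑-map _ (deconc (proj₂ s)) _)
    (trans (∑-*ˡ (deconc (proj₂ s)) (proj₁ s) _) (cong (proj₁ s *ℚ_) (∑-deconc (proj₂ s) G)))))

  -- Associativity of the quasi-shuffle product

  ≟0ℚ : (x : ℚ) → Maybe (0ℚ ≡ x)
  ≟0ℚ x with 0ℚ ℚP.≟ x
  ... | yes p = just p
  ... | no _ = nothing

  ℚ-almostRing : AlmostCommutativeRing 0ℓ 0ℓ
  ℚ-almostRing = fromCommutativeRing ℚP.+-*-commutativeRing ≟0ℚ

  qsh-[]ʳ : ∀ u → qsh u [] ≡ [ u ]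
  qsh-[]ʳ [] = refl
  qsh-[]ʳ (x ∷ u) = refl

  q+0≡q : ∀ q → q +ℚ 0ℚ ≡ q
  q+0≡q = ℚP.+-identityʳ

  ∑⧢-[]ˡ : ∀ v F → ∑⧢ [] v F ≡ F v
  ∑⧢-[]ˡ v F = q+0≡q (F v)

  ∑⧢-[]ʳ : ∀ u F → ∑⧢ u [] F ≡ F u
  ∑⧢-[]ʳ u F = trans (cong (λ l → ∑ l F) (qsh-[]ʳ u)) (q+0≡q (F u))

  ∑⧢-cong : ∀ u v {F F'} → (∀ w → F w ≡ F' w) → ∑⧢ u v F ≡ ∑⧢ u v F'
  ∑⧢-cong u v h = ∑-cong (qsh u v) h

  ∑⧢-∷ : ∀ a u b v F → ∑⧢ (a ∷ u) (b ∷ v) F ≡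
    ∑⧢ u (b ∷ v) (λ w → F (a ∷ w)) +ℚ (∑⧢ (a ∷ u) v (λ w → F (b ∷ w)) +ℚ ∑⧢ u v (λ w → F ((a +ℤ b) ∷ w)))
  ∑⧢-∷ a u b v F =
    trans (∑-++ (map (a ∷_) (qsh u (b ∷ v))) _ F)
    (cong₂ _+ℚ_ (∑-map (a ∷_) (qsh u (b ∷ v)) F)
      (trans (∑-++ (map (b ∷_) (qsh (a ∷ u) v)) _ F)
        (cong₂ _+ℚ_ (∑-map (b ∷_) (qsh (a ∷ u) v) F) (∑-map ((a +ℤ b) ∷_) (qsh u v) F))))

  ∑⧢ʳ : List Word → Word → (Word → ℚ) → ℚ
  ∑⧢ʳ l w F = ∑ l (λ t → ∑⧢ t w F)

  ∑⧢ˡ : Word → List Word → (Word → ℚ) → ℚ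
  ∑⧢ˡ u l F = ∑ l (λ t → ∑⧢ u t F)

  ∑⧢ʳ-++ : ∀ l m w F → ∑⧢ʳ (l ++ m) w F ≡ ∑⧢ʳ l w F +ℚ ∑⧢ʳ m w F
  ∑⧢ʳ-++ l m w F = ∑-++ l m _

  ∑⧢ˡ-++ : ∀ u l m F → ∑⧢ˡ u (l ++ m) F ≡ ∑⧢ˡ u l F +ℚ ∑⧢ˡ u m F
  ∑⧢ˡ-++ u l m F = ∑-++ l m _

  ∑⧢ʳ-∷ : ∀ x l c w F → ∑⧢ʳ (map (x ∷_) l) (c ∷ w) F ≡
    ∑⧢ʳ l (c ∷ w) (λ t → F (x ∷ t)) +ℚ (∑⧢ʳ (map (x ∷_) l) w (λ t → F (c ∷ t)) +ℚ ∑⧢ʳ l w (λ t → F ((x +ℤ c) ∷ t)))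
  ∑⧢ʳ-∷ x l c w F = begin
    ∑⧢ʳ (map (x ∷_) l) (c ∷ w) F ≡⟨ ∑-map (x ∷_) l _ ⟩
    ∑ l (λ t → ∑⧢ (x ∷ t) (c ∷ w) F) ≡⟨ ∑-cong l (λ t → ∑⧢-∷ x t c w F) ⟩
    ∑ l (λ t → ∑⧢ t (c ∷ w) (λ s → F (x ∷ s)) +ℚ (∑⧢ (x ∷ t) w (λ s → F (c ∷ s)) +ℚ ∑⧢ t w (λ s → F ((x +ℤ c) ∷ s))))
      ≡⟨ ∑-+ l _ _ ⟩
    _ ≡⟨ cong (∑⧢ʳ l (c ∷ w) (λ t → F (x ∷ t)) +ℚ_) (trans (∑-+ l _ _)
         (cong (_+ℚ ∑⧢ʳ l w (λ t → F ((x +ℤ c) ∷ t))) (sym (∑-map (x ∷_) l _)))) ⟩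
    _ ∎

  ∑⧢ˡ-∷ : ∀ a u y l F → ∑⧢ˡ (a ∷ u) (map (y ∷_) l) F ≡
    ∑⧢ˡ u (map (y ∷_) l) (λ t → F (a ∷ t)) +ℚ (∑⧢ˡ (a ∷ u) l (λ t → F (y ∷ t)) +ℚ ∑⧢ˡ u l (λ t → F ((a +ℤ y) ∷ t)))
  ∑⧢ˡ-∷ a u y l F = begin
    ∑⧢ˡ (a ∷ u) (map (y ∷_) l) F ≡⟨ ∑-map (y ∷_) l _ ⟩
    ∑ l (λ t → ∑⧢ (a ∷ u) (y ∷ t) F) ≡⟨ ∑-cong l (λ t → ∑⧢-∷ a u y t F) ⟩
    _ ≡⟨ ∑-+ l _ _ ⟩
    _ ≡⟨ cong₂ _+ℚ_ (sym (∑-map (y ∷_) l _)) (∑-+ l _ _) ⟩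
    _ ∎

  regroup₉ : ∀ (A1 A2 A3 B1 B2 B3 C1 C2 C3 : ℚ) →
    (A1 +ℚ (A2 +ℚ A3)) +ℚ ((B1 +ℚ (B2 +ℚ B3)) +ℚ (C1 +ℚ (C2 +ℚ C3))) ≡
    A1 +ℚ ((A2 +ℚ (B2 +ℚ C2)) +ℚ (A3 +ℚ (B1 +ℚ (B3 +ℚ (C1 +ℚ C3)))))
  regroup₉ = solve-∀ ℚ-almostRing

  regroup₉′ : ∀ (P1 P2 P3 Q1 Q2 Q3 R1 R2 R3 : ℚ) →
    (P1 +ℚ (P2 +ℚ P3)) +ℚ ((Q1 +ℚ (Q2 +ℚ Q3)) +ℚ (R1 +ℚ (R2 +ℚ R3))) ≡
    (P1 +ℚ (Q1 +ℚ R1)) +ℚ (Q2 +ℚ (Q3 +ℚ (P2 +ℚ (R2 +ℚ (P3 +ℚ R3)))))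
  regroup₉′ = solve-∀ ℚ-almostRing

  ∑⧢ʳ-qsh-expand : ∀ a u b v c w F →
    ∑⧢ʳ (qsh (a ∷ u) (b ∷ v)) (c ∷ w) F ≡
      ∑⧢ʳ (qsh u (b ∷ v)) (c ∷ w) (λ t → F (a ∷ t)) +ℚ (∑⧢ʳ (qsh (a ∷ u) (b ∷ v)) w (λ t → F (c ∷ t))
      +ℚ (∑⧢ʳ (qsh u (b ∷ v)) w (λ t → F ((a +ℤ c) ∷ t)) +ℚ (∑⧢ʳ (qsh (a ∷ u) v) (c ∷ w) (λ t → F (b ∷ t))
      +ℚ (∑⧢ʳ (qsh (a ∷ u) v) w (λ t → F ((b +ℤ c) ∷ t)) +ℚ (∑⧢ʳ (qsh u v) (c ∷ w) (λ t → F ((a +ℤ b) ∷ t))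
      +ℚ ∑⧢ʳ (qsh u v) w (λ t → F (((a +ℤ b) +ℤ c) ∷ t)))))))
  ∑⧢ʳ-qsh-expand a u b v c w F = begin
    ∑⧢ʳ (La ++ (Lb ++ Lab)) (c ∷ w) F
      ≡⟨ trans (∑⧢ʳ-++ La _ _ F) (cong (∑⧢ʳ La (c ∷ w) F +ℚ_) (∑⧢ʳ-++ Lb Lab _ F)) ⟩
    ∑⧢ʳ La (c ∷ w) F +ℚ (∑⧢ʳ Lb (c ∷ w) F +ℚ ∑⧢ʳ Lab (c ∷ w) F)
      ≡⟨ cong₂ _+ℚ_ (∑⧢ʳ-∷ a (qsh u (b ∷ v)) c w F)
                    (cong₂ _+ℚ_ (∑⧢ʳ-∷ b (qsh (a ∷ u) v) c w F) (∑⧢ʳ-∷ (a +ℤ b) (qsh u v) c w F)) ⟩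
    (A1 +ℚ (A2 +ℚ A3)) +ℚ ((B1 +ℚ (B2 +ℚ B3)) +ℚ (C1 +ℚ (C2 +ℚ C3)))
      ≡⟨ regroup₉ A1 A2 A3 B1 B2 B3 C1 C2 C3 ⟩
    A1 +ℚ ((A2 +ℚ (B2 +ℚ C2)) +ℚ (A3 +ℚ (B1 +ℚ (B3 +ℚ (C1 +ℚ C3)))))
      ≡⟨ cong (λ m → A1 +ℚ (m +ℚ (A3 +ℚ (B1 +ℚ (B3 +ℚ (C1 +ℚ C3))))))
              (sym (trans (∑⧢ʳ-++ La _ w _) (cong (A2 +ℚ_) (∑⧢ʳ-++ Lb Lab w _)))) ⟩
    A1 +ℚ (∑⧢ʳ (La ++ (Lb ++ Lab)) w (λ t → F (c ∷ t)) +ℚ (A3 +ℚ (B1 +ℚ (B3 +ℚ (C1 +ℚ C3))))) ∎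
    where
    La Lb Lab : List Word
    La = map (a ∷_) (qsh u (b ∷ v))
    Lb = map (b ∷_) (qsh (a ∷ u) v)
    Lab = map ((a +ℤ b) ∷_) (qsh u v)
    A1 A2 A3 B1 B2 B3 C1 C2 C3 : ℚ
    A1 = ∑⧢ʳ (qsh u (b ∷ v)) (c ∷ w) (λ t → F (a ∷ t))
    A2 = ∑⧢ʳ La w (λ t → F (c ∷ t))
    A3 = ∑⧢ʳ (qsh u (b ∷ v)) w (λ t → F ((a +ℤ c) ∷ t))
    B1 = ∑⧢ʳ (qsh (a ∷ u) v) (c ∷ w) (λ t → F (b ∷ t))
    B2 = ∑⧢ʳ Lb w (λ t → F (c ∷ t))
    B3 = ∑⧢ʳ (qsh (a ∷ u) v) w (λ t → F ((b +ℤ c) ∷ t))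
    C1 = ∑⧢ʳ (qsh u v) (c ∷ w) (λ t → F ((a +ℤ b) ∷ t))
    C2 = ∑⧢ʳ Lab w (λ t → F (c ∷ t))
    C3 = ∑⧢ʳ (qsh u v) w (λ t → F (((a +ℤ b) +ℤ c) ∷ t))

  ∑⧢ˡ-qsh-expand : ∀ a u b v c w F →
    ∑⧢ˡ (a ∷ u) (qsh (b ∷ v) (c ∷ w)) F ≡
      ∑⧢ˡ u (qsh (b ∷ v) (c ∷ w)) (λ t → F (a ∷ t)) +ℚ (∑⧢ˡ (a ∷ u) (qsh (b ∷ v) w) (λ t → F (c ∷ t))
      +ℚ (∑⧢ˡ u (qsh (b ∷ v) w) (λ t → F ((a +ℤ c) ∷ t)) +ℚ (∑⧢ˡ (a ∷ u) (qsh v (c ∷ w)) (λ t → F (b ∷ t))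
      +ℚ (∑⧢ˡ (a ∷ u) (qsh v w) (λ t → F ((b +ℤ c) ∷ t)) +ℚ (∑⧢ˡ u (qsh v (c ∷ w)) (λ t → F ((a +ℤ b) ∷ t))
      +ℚ ∑⧢ˡ u (qsh v w) (λ t → F ((a +ℤ (b +ℤ c)) ∷ t)))))))
  ∑⧢ˡ-qsh-expand a u b v c w F = begin
    ∑⧢ˡ (a ∷ u) (Lb ++ (Lc ++ Lbc)) F
      ≡⟨ trans (∑⧢ˡ-++ (a ∷ u) Lb _ F) (cong (∑⧢ˡ (a ∷ u) Lb F +ℚ_) (∑⧢ˡ-++ (a ∷ u) Lc Lbc F)) ⟩
    ∑⧢ˡ (a ∷ u) Lb F +ℚ (∑⧢ˡ (a ∷ u) Lc F +ℚ ∑⧢ˡ (a ∷ u) Lbc F)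
      ≡⟨ cong₂ _+ℚ_ (∑⧢ˡ-∷ a u b (qsh v (c ∷ w)) F)
                    (cong₂ _+ℚ_ (∑⧢ˡ-∷ a u c (qsh (b ∷ v) w) F) (∑⧢ˡ-∷ a u (b +ℤ c) (qsh v w) F)) ⟩
    (P1 +ℚ (P2 +ℚ P3)) +ℚ ((Q1 +ℚ (Q2 +ℚ Q3)) +ℚ (R1 +ℚ (R2 +ℚ R3)))
      ≡⟨ regroup₉′ P1 P2 P3 Q1 Q2 Q3 R1 R2 R3 ⟩
    (P1 +ℚ (Q1 +ℚ R1)) +ℚ (Q2 +ℚ (Q3 +ℚ (P2 +ℚ (R2 +ℚ (P3 +ℚ R3)))))
      ≡⟨ cong (_+ℚ (Q2 +ℚ (Q3 +ℚ (P2 +ℚ (R2 +ℚ (P3 +ℚ R3))))))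
              (sym (trans (∑⧢ˡ-++ u Lb _ _) (cong (P1 +ℚ_) (∑⧢ˡ-++ u Lc Lbc _)))) ⟩
    ∑⧢ˡ u (Lb ++ (Lc ++ Lbc)) (λ t → F (a ∷ t)) +ℚ (Q2 +ℚ (Q3 +ℚ (P2 +ℚ (R2 +ℚ (P3 +ℚ R3))))) ∎
    where
    Lb Lc Lbc : List Word
    Lb = map (b ∷_) (qsh v (c ∷ w))
    Lc = map (c ∷_) (qsh (b ∷ v) w)
    Lbc = map ((b +ℤ c) ∷_) (qsh v w)
    P1 P2 P3 Q1 Q2 Q3 R1 R2 R3 : ℚ
    P1 = ∑⧢ˡ u Lb (λ t → F (a ∷ t))
    P2 = ∑⧢ˡ (a ∷ u) (qsh v (c ∷ w)) (λ t → F (b ∷ t))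
    P3 = ∑⧢ˡ u (qsh v (c ∷ w)) (λ t → F ((a +ℤ b) ∷ t))
    Q1 = ∑⧢ˡ u Lc (λ t → F (a ∷ t))
    Q2 = ∑⧢ˡ (a ∷ u) (qsh (b ∷ v) w) (λ t → F (c ∷ t))
    Q3 = ∑⧢ˡ u (qsh (b ∷ v) w) (λ t → F ((a +ℤ c) ∷ t))
    R1 = ∑⧢ˡ u Lbc (λ t → F (a ∷ t))
    R2 = ∑⧢ˡ (a ∷ u) (qsh v w) (λ t → F ((b +ℤ c) ∷ t))
    R3 = ∑⧢ˡ u (qsh v w) (λ t → F ((a +ℤ (b +ℤ c)) ∷ t))

  ∑⧢-assoc : ∀ u v w F → ∑⧢ʳ (qsh u v) w F ≡ ∑⧢ˡ u (qsh v w) F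
  ∑⧢-assoc [] v w F = trans (q+0≡q _) (sym (∑-cong (qsh v w) (λ t → ∑⧢-[]ˡ t F)))
  ∑⧢-assoc (a ∷ u) [] w F = refl
  ∑⧢-assoc (a ∷ u) (b ∷ v) [] F = trans (∑-cong (qsh (a ∷ u) (b ∷ v)) (λ t → ∑⧢-[]ʳ t F)) (sym (q+0≡q _))
  ∑⧢-assoc (a ∷ u) (b ∷ v) (c ∷ w) F =
    trans (∑⧢ʳ-qsh-expand a u b v c w F) (trans
      (cong₂ _+ℚ_ (∑⧢-assoc u (b ∷ v) (c ∷ w) _) (cong₂ _+ℚ_ (∑⧢-assoc (a ∷ u) (b ∷ v) w _)
      (cong₂ _+ℚ_ (∑⧢-assoc u (b ∷ v) w _) (cong₂ _+ℚ_ (∑⧢-assoc (a ∷ u) v (c ∷ w) _)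
      (cong₂ _+ℚ_ (∑⧢-assoc (a ∷ u) v w _) (cong₂ _+ℚ_ (∑⧢-assoc u v (c ∷ w) _)
      (trans (∑⧢-assoc u v w _) (cong (λ d → ∑⧢ˡ u (qsh v w) (λ t → F (d ∷ t))) (ℤP.+-assoc a b c)))))))))
    (sym (∑⧢ˡ-qsh-expand a u b v c w F)))

  -- Deconcatenation is multiplicative and coassociative

  ∑Δ-∷ : ∀ c w G → ∑Δ (c ∷ w) G ≡ G [] (c ∷ w) +ℚ ∑Δ w (λ p s → G (c ∷ p) s)
  ∑Δ-∷ c w G = refl

  ∑Δ-+ : ∀ w G H → ∑Δ w (λ p s → G p s +ℚ H p s) ≡ ∑Δ w G +ℚ ∑Δ w H
  ∑Δ-+ w G H = trans (sym (∑-deconc w _)) (trans (∑-+ (deconc w) _ _) (cong₂ _+ℚ_ (∑-deconc w G) (∑-deconc w H)))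

  ∑Δ-zero : ∀ w G → (∀ p s → G p s ≡ 0ℚ) → ∑Δ w G ≡ 0ℚ
  ∑Δ-zero w G h = trans (sym (∑-deconc w G)) (∑-zero (deconc w) (λ t → h (proj₁ t) (proj₂ t)))

  ∑Δ⧢Δ : Word → Word → (Word → Word → ℚ) → ℚ
  ∑Δ⧢Δ u v G = ∑Δ u (λ u1 u2 → ∑Δ v (λ v1 v2 → ∑⧢ u1 v1 (λ x → ∑⧢ u2 v2 (λ y → G x y))))

  ∑Δ-cong : ∀ w G G' → (∀ p s → G p s ≡ G' p s) → ∑Δ w G ≡ ∑Δ w G'
  ∑Δ-cong w G G' h = trans (sym (∑-deconc w G)) (trans (∑-cong (deconc w) (λ t → h (proj₁ t) (proj₂ t))) (∑-deconc w G'))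

  ∑Δ⧢Δ-∷ : ∀ a u b v G → ∑Δ⧢Δ (a ∷ u) (b ∷ v) G ≡
    ∑⧢ (a ∷ u) (b ∷ v) (G []) +ℚ (∑Δ⧢Δ u (b ∷ v) (λ x → G (a ∷ x))
      +ℚ (∑Δ⧢Δ (a ∷ u) v (λ x → G (b ∷ x)) +ℚ ∑Δ⧢Δ u v (λ x → G ((a +ℤ b) ∷ x))))
  ∑Δ⧢Δ-∷ a u b v G = begin
    ∑Δ⧢Δ (a ∷ u) (b ∷ v) G                                ≡⟨ expand ⟩
    (S +ℚ XB) +ℚ (YA +ℚ (ZA +ℚ (ZB +ℚ ZAB)))               ≡⟨ regroup S XB YA ZA ZB ZAB ⟩
    S +ℚ ((YA +ℚ ZA) +ℚ ((XB +ℚ ZB) +ℚ ZAB))               ≡⟨ cong (S +ℚ_) (cong₂ _+ℚ_ (sym splitA) (cong (_+ℚ ZAB) (sym splitB))) ⟩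
    S +ℚ (∑Δ⧢Δ u (b ∷ v) (λ x → G (a ∷ x)) +ℚ (∑Δ⧢Δ (a ∷ u) v (λ x → G (b ∷ x)) +ℚ ZAB)) ∎
    where
    regroup : ∀ (S XB YA ZA ZB ZAB : ℚ) →
      (S +ℚ XB) +ℚ (YA +ℚ (ZA +ℚ (ZB +ℚ ZAB))) ≡ S +ℚ ((YA +ℚ ZA) +ℚ ((XB +ℚ ZB) +ℚ ZAB))
    regroup = solve-∀ ℚ-almostRing
    ya xb : Word → Word → ℚ
    ya p s = ∑⧢ s (b ∷ v) (G (a ∷ p))
    xb p' s' = ∑⧢ (a ∷ u) s' (G (b ∷ p'))
    za zb zab : Word → Word → Word → Word → ℚ
    za p s p' s' = ∑⧢ p (b ∷ p') (λ x → ∑⧢ s s' (G (a ∷ x)))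
    zb p s p' s' = ∑⧢ (a ∷ p) p' (λ x → ∑⧢ s s' (G (b ∷ x)))
    zab p s p' s' = ∑⧢ p p' (λ x → ∑⧢ s s' (G ((a +ℤ b) ∷ x)))
    S YA XB ZA ZB ZAB : ℚ
    S = ∑⧢ (a ∷ u) (b ∷ v) (G [])
    YA = ∑Δ u ya
    XB = ∑Δ v xb
    ZA = ∑Δ u (λ p s → ∑Δ v (za p s))
    ZB = ∑Δ u (λ p s → ∑Δ v (zb p s))
    ZAB = ∑Δ u (λ p s → ∑Δ v (zab p s))
    splitA : ∑Δ⧢Δ u (b ∷ v) (λ x → G (a ∷ x)) ≡ YA +ℚ ZA
    splitA = trans (∑Δ-cong u _ (λ p s → ya p s +ℚ ∑Δ v (za p s))
               (λ p s → cong (_+ℚ ∑Δ v (za p s)) (∑⧢-[]ʳ p (λ x → ∑⧢ s (b ∷ v) (G (a ∷ x))))))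
               (∑Δ-+ u ya (λ p s → ∑Δ v (za p s)))
    splitB : ∑Δ⧢Δ (a ∷ u) v (λ x → G (b ∷ x)) ≡ XB +ℚ ZB
    splitB = cong (_+ℚ ZB) (∑Δ-cong v _ xb (λ p s → ∑⧢-[]ˡ p (λ x → ∑⧢ (a ∷ u) s (G (b ∷ x)))))
    expandInner : ∀ p s → ∑Δ (b ∷ v) (λ v1 v2 → ∑⧢ (a ∷ p) v1 (λ x → ∑⧢ s v2 (G x)))
                          ≡ ya p s +ℚ (∑Δ v (za p s) +ℚ (∑Δ v (zb p s) +ℚ ∑Δ v (zab p s)))
    expandInner p s = cong₂ _+ℚ_ (∑⧢-[]ʳ (a ∷ p) (λ x → ∑⧢ s (b ∷ v) (G x)))
      (trans (∑Δ-cong v _ (λ p' s' → za p s p' s' +ℚ (zb p s p' s' +ℚ zab p s p' s'))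
                (λ p' s' → ∑⧢-∷ a p b p' (λ x → ∑⧢ s s' (G x))))
      (trans (∑Δ-+ v (za p s) (λ p' s' → zb p s p' s' +ℚ zab p s p' s'))
             (cong (∑Δ v (za p s) +ℚ_) (∑Δ-+ v (zb p s) (zab p s)))))
    expand : ∑Δ⧢Δ (a ∷ u) (b ∷ v) G ≡ (S +ℚ XB) +ℚ (YA +ℚ (ZA +ℚ (ZB +ℚ ZAB)))
    expand = cong₂ _+ℚ_
      (cong₂ _+ℚ_ (q+0≡q S) (∑Δ-cong v _ xb (λ p s → q+0≡q (xb p s))))
      (trans (∑Δ-cong u _ (λ p s → ya p s +ℚ (∑Δ v (za p s) +ℚ (∑Δ v (zb p s) +ℚ ∑Δ v (zab p s)))) expandInner)
      (trans (∑Δ-+ u ya _) (cong (YA +ℚ_) (trans (∑Δ-+ u (λ p s → ∑Δ v (za p s)) _)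
        (cong (ZA +ℚ_) (∑Δ-+ u (λ p s → ∑Δ v (zb p s)) (λ p s → ∑Δ v (zab p s))))))))

  ∑-qsh-∑Δ-∷ : ∀ a u b v G → ∑ (qsh (a ∷ u) (b ∷ v)) (λ w → ∑Δ w G) ≡
    ∑⧢ (a ∷ u) (b ∷ v) (G []) +ℚ (∑ (qsh u (b ∷ v)) (λ w → ∑Δ w (λ x → G (a ∷ x)))
      +ℚ (∑ (qsh (a ∷ u) v) (λ w → ∑Δ w (λ x → G (b ∷ x))) +ℚ ∑ (qsh u v) (λ w → ∑Δ w (λ x → G ((a +ℤ b) ∷ x)))))
  ∑-qsh-∑Δ-∷ a u b v G = begin
    ∑ (La ++ (Lb ++ Lab)) (λ w → ∑Δ w G)
      ≡⟨ trans (∑-++ La (Lb ++ Lab) _) (cong (∑ La (λ w → ∑Δ w G) +ℚ_) (∑-++ Lb Lab _)) ⟩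
    ∑ La (λ w → ∑Δ w G) +ℚ (∑ Lb (λ w → ∑Δ w G) +ℚ ∑ Lab (λ w → ∑Δ w G))
      ≡⟨ cong₂ _+ℚ_ (split a (qsh u (b ∷ v))) (cong₂ _+ℚ_ (split b (qsh (a ∷ u) v)) (split (a +ℤ b) (qsh u v))) ⟩
    (Ea +ℚ Ma) +ℚ ((Eb +ℚ Mb) +ℚ (Eab +ℚ Mab)) ≡⟨ regroup Ea Ma Eb Mb Eab Mab ⟩
    (Ea +ℚ (Eb +ℚ Eab)) +ℚ (Ma +ℚ (Mb +ℚ Mab)) ≡⟨ cong (_+ℚ (Ma +ℚ (Mb +ℚ Mab))) (sym (∑⧢-∷ a u b v (G []))) ⟩
    ∑⧢ (a ∷ u) (b ∷ v) (G []) +ℚ (Ma +ℚ (Mb +ℚ Mab)) ∎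
    where
    La Lb Lab : List Word
    La = map (a ∷_) (qsh u (b ∷ v))
    Lb = map (b ∷_) (qsh (a ∷ u) v)
    Lab = map ((a +ℤ b) ∷_) (qsh u v)
    Ea Eb Eab Ma Mb Mab : ℚ
    Ea = ∑⧢ u (b ∷ v) (λ w → G [] (a ∷ w))
    Eb = ∑⧢ (a ∷ u) v (λ w → G [] (b ∷ w))
    Eab = ∑⧢ u v (λ w → G [] ((a +ℤ b) ∷ w))
    Ma = ∑ (qsh u (b ∷ v)) (λ w → ∑Δ w (λ x → G (a ∷ x)))
    Mb = ∑ (qsh (a ∷ u) v) (λ w → ∑Δ w (λ x → G (b ∷ x)))
    Mab = ∑ (qsh u v) (λ w → ∑Δ w (λ x → G ((a +ℤ b) ∷ x)))
    split : ∀ x l → ∑ (map (x ∷_) l) (λ w → ∑Δ w G) ≡ ∑ l (λ w → G [] (x ∷ w)) +ℚ ∑ l (λ w → ∑Δ w (λ p s → G (x ∷ p) s))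
    split x l = trans (∑-map (x ∷_) l (λ w → ∑Δ w G)) (∑-+ l (λ w → G [] (x ∷ w)) (λ w → ∑Δ w (λ p s → G (x ∷ p) s)))
    regroup : ∀ (Ea Ma Eb Mb Eab Mab : ℚ) →
      (Ea +ℚ Ma) +ℚ ((Eb +ℚ Mb) +ℚ (Eab +ℚ Mab)) ≡ (Ea +ℚ (Eb +ℚ Eab)) +ℚ (Ma +ℚ (Mb +ℚ Mab))
    regroup = solve-∀ ℚ-almostRing

  ∑Δ-⧢ : ∀ u v G → ∑ (qsh u v) (λ w → ∑Δ w G) ≡ ∑Δ⧢Δ u v G
  ∑Δ-⧢ [] v G = cong (_+ℚ 0ℚ) (∑Δ-cong v G (λ v1 v2 → ∑⧢ [] v1 (λ x → ∑⧢ [] v2 (G x)))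
    (λ p s → sym (trans (∑⧢-[]ˡ p (λ x → ∑⧢ [] s (G x))) (∑⧢-[]ˡ s (G p)))))
  ∑Δ-⧢ (a ∷ u) [] G = trans (q+0≡q (∑Δ (a ∷ u) G)) (∑Δ-cong (a ∷ u) G (λ u1 u2 → ∑Δ [] (λ v1 v2 → ∑⧢ u1 v1 (λ x → ∑⧢ u2 v2 (G x))))
    (λ p s → sym (trans (q+0≡q (∑⧢ p [] (λ x → ∑⧢ s [] (G x)))) (trans (∑⧢-[]ʳ p (λ x → ∑⧢ s [] (G x))) (∑⧢-[]ʳ s (G p))))))
  ∑Δ-⧢ (a ∷ u) (b ∷ v) G =
    trans (∑-qsh-∑Δ-∷ a u b v G)
    (trans (cong (∑⧢ (a ∷ u) (b ∷ v) (G []) +ℚ_)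
      (cong₂ _+ℚ_ (∑Δ-⧢ u (b ∷ v) (λ x → G (a ∷ x)))
      (cong₂ _+ℚ_ (∑Δ-⧢ (a ∷ u) v (λ x → G (b ∷ x))) (∑Δ-⧢ u v (λ x → G ((a +ℤ b) ∷ x))))))
    (sym (∑Δ⧢Δ-∷ a u b v G)))

  ∑Δ-coassoc : ∀ w (H : Word → Word → Word → ℚ) →
    ∑Δ w (λ p s → ∑Δ p (λ p1 p2 → H p1 p2 s)) ≡ ∑Δ w (λ p s → ∑Δ s (λ s1 s2 → H p s1 s2))
  ∑Δ-coassoc [] H = refl
  ∑Δ-coassoc (a ∷ w) H = begin
    (H [] [] (a ∷ w) +ℚ 0ℚ) +ℚ ∑Δ w (λ p s → ∑Δ (a ∷ p) (λ p1 p2 → H p1 p2 s))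
      ≡⟨ cong₂ _+ℚ_ (q+0≡q (H [] [] (a ∷ w))) (∑Δ-+ w (λ p s → H [] (a ∷ p) s) (λ p s → ∑Δ p (λ p1 p2 → H (a ∷ p1) p2 s))) ⟩
    H [] [] (a ∷ w) +ℚ (∑Δ w (λ p s → H [] (a ∷ p) s) +ℚ ∑Δ w (λ p s → ∑Δ p (λ p1 p2 → H (a ∷ p1) p2 s)))
      ≡⟨ cong (λ z → H [] [] (a ∷ w) +ℚ (∑Δ w (λ p s → H [] (a ∷ p) s) +ℚ z)) (∑Δ-coassoc w (λ p1 p2 s → H (a ∷ p1) p2 s)) ⟩
    H [] [] (a ∷ w) +ℚ (∑Δ w (λ p s → H [] (a ∷ p) s) +ℚ ∑Δ w (λ p s → ∑Δ s (λ s1 s2 → H (a ∷ p) s1 s2)))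
      ≡⟨ sym (ℚP.+-assoc (H [] [] (a ∷ w)) _ _) ⟩
    ∑Δ (a ∷ w) (λ p s → ∑Δ s (λ s1 s2 → H p s1 s2)) ∎

  εw : Word → ℚ
  εw [] = 1ℚ
  εw (_ ∷ _) = 0ℚ

  ∑⧢-εw : ∀ u v → ∑⧢ u v εw ≡ εw u *ℚ εw v
  ∑⧢-εw [] v = trans (q+0≡q (εw v)) (sym (ℚP.*-identityˡ (εw v)))
  ∑⧢-εw (a ∷ u) [] = q+0≡q 0ℚ
  ∑⧢-εw (a ∷ u) (b ∷ v) = trans (∑-++ (map (a ∷_) (qsh u (b ∷ v))) _ εw)
    (trans (cong₂ _+ℚ_ (trans (∑-map _ (qsh u (b ∷ v)) εw) (∑-zero (qsh u (b ∷ v)) (λ _ → refl)))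
      (trans (∑-++ (map (b ∷_) (qsh (a ∷ u) v)) _ εw) (cong₂ _+ℚ_
        (trans (∑-map _ (qsh (a ∷ u) v) εw) (∑-zero (qsh (a ∷ u) v) (λ _ → refl)))
        (trans (∑-map _ (qsh u v) εw) (∑-zero (qsh u v) (λ _ → refl))))))
     refl)

  ∑Δ-εwˡ : ∀ w (G : Word → Word → ℚ) → ∑Δ w (λ p s → εw p *ℚ G p s) ≡ G [] w
  ∑Δ-εwˡ [] G = trans (q+0≡q (1ℚ *ℚ G [] [])) (ℚP.*-identityˡ (G [] []))
  ∑Δ-εwˡ (a ∷ w) G = trans (∑Δ-∷ a w (λ p s → εw p *ℚ G p s))
    (trans (cong (1ℚ *ℚ G [] (a ∷ w) +ℚ_) (∑Δ-zero w _ (λ p s → ℚP.*-zeroˡ (G (a ∷ p) s))))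
    (trans (q+0≡q (1ℚ *ℚ G [] (a ∷ w))) (ℚP.*-identityˡ (G [] (a ∷ w)))))

  ∑Δ-εwʳ : ∀ w (G : Word → Word → ℚ) → ∑Δ w (λ p s → G p s *ℚ εw s) ≡ G w []
  ∑Δ-εwʳ [] G = trans (q+0≡q (G [] [] *ℚ 1ℚ)) (ℚP.*-identityʳ (G [] []))
  ∑Δ-εwʳ (a ∷ w) G = trans (∑Δ-∷ a w (λ p s → G p s *ℚ εw s))
    (trans (cong₂ _+ℚ_ (ℚP.*-zeroʳ (G [] (a ∷ w))) (∑Δ-εwʳ w (λ p s → G (a ∷ p) s)))
    (ℚP.+-identityˡ (G (a ∷ w) [])))

  ∗-cong : ∀ {x x' y y'} → x ≈ x' → y ≈ y' → x ∗ y ≈ x' ∗ y'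
  ∗-cong {x} {x'} {y} {y'} p q = mk≈ λ F → begin
    ⟨ x ∗ y ∣ F ⟩ ≡⟨ pair-∗ x y F ⟩
    ⟨ x ∣ (λ u → ⟨ y ∣ (λ v → ∑⧢ u v F) ⟩) ⟩ ≡⟨ ≈app p _ ⟩
    ⟨ x' ∣ (λ u → ⟨ y ∣ (λ v → ∑⧢ u v F) ⟩) ⟩ ≡⟨ pair-cong x' (λ u → ≈app q _) ⟩
    ⟨ x' ∣ (λ u → ⟨ y' ∣ (λ v → ∑⧢ u v F) ⟩) ⟩ ≡⟨ sym (pair-∗ x' y' F) ⟩
    ⟨ x' ∗ y' ∣ F ⟩ ∎

  ∗-congˡ : ∀ {x x'} y → x ≈ x' → x ∗ y ≈ x' ∗ y
  ∗-congˡ {x} {x'} y p = ∗-cong {x} {x'} {y} {y} p (≈-refl {y})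

  ∗-congʳ : ∀ x {y y'} → y ≈ y' → x ∗ y ≈ x ∗ y'
  ∗-congʳ x {y} {y'} q = ∗-cong {x} {x} {y} {y'} (≈-refl {x}) q

  ∗-assoc : ∀ x y z → (x ∗ y) ∗ z ≈ x ∗ (y ∗ z)
  ∗-assoc x y z = mk≈ λ F → begin
    ⟨ (x ∗ y) ∗ z ∣ F ⟩ ≡⟨ pair-∗ (x ∗ y) z F ⟩
    ⟨ x ∗ y ∣ (λ t → ⟨ z ∣ (λ w → ∑⧢ t w F) ⟩) ⟩ ≡⟨ pair-∗ x y _ ⟩
    ⟨ x ∣ (λ u → ⟨ y ∣ (λ v → ∑⧢ u v (λ t → ⟨ z ∣ (λ w → ∑⧢ t w F) ⟩)) ⟩) ⟩
      ≡⟨ pair-cong x (λ u → pair-cong y (λ v → sym (pair-∑ z (qsh u v) (λ t w → ∑⧢ t w F)))) ⟩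
    ⟨ x ∣ (λ u → ⟨ y ∣ (λ v → ⟨ z ∣ (λ w → ∑⧢ʳ (qsh u v) w F) ⟩) ⟩) ⟩
      ≡⟨ pair-cong x (λ u → pair-cong y (λ v → pair-cong z (λ w → ∑⧢-assoc u v w F))) ⟩
    ⟨ x ∣ (λ u → ⟨ y ∣ (λ v → ⟨ z ∣ (λ w → ∑⧢ˡ u (qsh v w) F) ⟩) ⟩) ⟩
      ≡⟨ sym (pair-cong x (λ u → pair-∗ y z (λ t → ∑⧢ u t F))) ⟩
    ⟨ x ∣ (λ u → ⟨ y ∗ z ∣ (λ t → ∑⧢ u t F) ⟩) ⟩ ≡⟨ sym (pair-∗ x (y ∗ z) F) ⟩
    ⟨ x ∗ (y ∗ z) ∣ F ⟩ ∎

  pair-𝟙 : ∀ F → ⟨ 𝟙 ∣ F ⟩ ≡ F []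
  pair-𝟙 F = pair-⟪⟫ [] F

  ∗-identityˡ : ∀ x → 𝟙 ∗ x ≈ x
  ∗-identityˡ x = mk≈ λ F → trans (pair-∗ 𝟙 x F) (trans (pair-𝟙 (λ u → ⟨ x ∣ (λ v → ∑⧢ u v F) ⟩)) (pair-cong x (λ v → ∑⧢-[]ˡ v F)))

  ∗-identityʳ : ∀ x → x ∗ 𝟙 ≈ x
  ∗-identityʳ x = mk≈ λ F → trans (pair-∗ x 𝟙 F) (pair-cong x (λ u → trans (pair-𝟙 (λ v → ∑⧢ u v F)) (∑⧢-[]ʳ u F)))

  ++-cong : ∀ {x x' y y'} → x ≈ x' → y ≈ y' → x ++ y ≈ x' ++ y'
  ++-cong {x} {x'} {y} {y'} p q = mk≈ λ F → trans (pair-++ x y F) (trans (cong₂ _+ℚ_ (≈app p F) (≈app q F)) (sym (pair-++ x' y' F)))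

  ++-comm : ∀ x y → x ++ y ≈ y ++ x
  ++-comm x y = mk≈ λ F → trans (pair-++ x y F) (trans (ℚP.+-comm ⟨ x ∣ F ⟩ ⟨ y ∣ F ⟩) (sym (pair-++ y x F)))

  ++-assoc : ∀ x y z → (x ++ y) ++ z ≈ x ++ (y ++ z)
  ++-assoc x y z = mk≈ λ F → trans (pair-++ (x ++ y) z F) (trans (cong (_+ℚ ⟨ z ∣ F ⟩) (pair-++ x y F))
    (trans (ℚP.+-assoc ⟨ x ∣ F ⟩ ⟨ y ∣ F ⟩ ⟨ z ∣ F ⟩) (trans (cong (⟨ x ∣ F ⟩ +ℚ_) (sym (pair-++ y z F))) (sym (pair-++ x (y ++ z) F)))))

  ++-identityʳ : ∀ x → x ++ [] ≈ x
  ++-identityʳ x = mk≈ λ F → trans (pair-++ x [] F) (q+0≡q _)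

  scale-cong : ∀ q {x x'} → x ≈ x' → scale q x ≈ scale q x'
  scale-cong q {x} {x'} p = mk≈ λ F → trans (pair-scale q x F) (trans (cong (q *ℚ_) (≈app p F)) (sym (pair-scale q x' F)))

  concatMap-cong : ∀ {X : Set} (l : List X) {f g : X → Lin} → (∀ t → f t ≈ g t) → concatMap f l ≈ concatMap g l
  concatMap-cong l {f} {g} h = mk≈ λ F → trans (pair-concatMap f l F) (trans (∑-cong l (λ t → ≈app (h t) F)) (sym (pair-concatMap g l F)))

  ∗-scaleˡ : ∀ q x y → scale q x ∗ y ≈ scale q (x ∗ y)
  ∗-scaleˡ q x y = mk≈ λ F → trans (pair-∗ (scale q x) y F) (trans (pair-scale q x _)
    (trans (cong (q *ℚ_) (sym (pair-∗ x y F))) (sym (pair-scale q (x ∗ y) F))))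

  ∗-scaleʳ : ∀ q x y → x ∗ scale q y ≈ scale q (x ∗ y)
  ∗-scaleʳ q x y = mk≈ λ F → trans (pair-∗ x (scale q y) F) (trans (pair-cong x (λ u → pair-scale q y _))
    (trans (pair-* x q _) (trans (cong (q *ℚ_) (sym (pair-∗ x y F))) (sym (pair-scale q (x ∗ y) F)))))

  ∗-concatMapˡ : ∀ {X : Set} (f : X → Lin) l y → concatMap f l ∗ y ≈ concatMap (λ t → f t ∗ y) l
  ∗-concatMapˡ f l y = mk≈ λ F → trans (pair-∗ (concatMap f l) y F) (trans (pair-concatMap f l _)
    (trans (∑-cong l (λ t → sym (pair-∗ (f t) y F))) (sym (pair-concatMap (λ t → f t ∗ y) l F))))

  ∗-concatMapʳ : ∀ {X : Set} x (f : X → Lin) l → x ∗ concatMap f l ≈ concatMap (λ t → x ∗ f t) l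
  ∗-concatMapʳ x f l = mk≈ λ F → trans (pair-∗ x (concatMap f l) F) (trans (pair-cong x (λ u → pair-concatMap f l _))
    (trans (pair-∑ x l _) (trans (∑-cong l (λ t → sym (pair-∗ x (f t) F))) (sym (pair-concatMap (λ t → x ∗ f t) l F)))))

  pair-⟪⟫∗⟪⟫ : ∀ u v F → ⟨ ⟪ u ⟫ ∗ ⟪ v ⟫ ∣ F ⟩ ≡ ∑⧢ u v F
  pair-⟪⟫∗⟪⟫ u v F = trans (pair-∗ ⟪ u ⟫ ⟪ v ⟫ F) (trans (pair-⟪⟫ u (λ u' → ⟨ ⟪ v ⟫ ∣ (λ v' → ∑⧢ u' v' F) ⟩)) (pair-⟪⟫ v
      (λ v' → ∑⧢ u v' F)))

  linExt-cong : ∀ S x x' → x ≈ x' → linExt S x ≈ linExt S x'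
  linExt-cong S x x' p = mk≈ λ F → trans (pair-linExt S x F) (trans (≈app p _) (sym (pair-linExt S x' F)))

  linExt-word : ∀ S w → linExt S ⟪ w ⟫ ≈ S w
  linExt-word S w = mk≈ λ F → trans (pair-linExt S ⟪ w ⟫ F) (pair-⟪⟫ w (λ u → ⟨ S u ∣ F ⟩))

  Δ-cong : ∀ {x y} → x ≈ y → Δ x ≈₂ Δ y
  Δ-cong {x} {y} p = mk≈₂ λ G → trans (pair₂-Δ x G) (trans (≈app p _) (sym (pair₂-Δ y G)))

  ++₂-cong : ∀ {x x' y y'} → x ≈₂ x' → y ≈₂ y' → x ++ y ≈₂ x' ++ y'
  ++₂-cong {x} {x'} {y} {y'} p q = mk≈₂ λ G → trans (pair₂-++ x y G) (trans (cong₂ _+ℚ_ (≈₂app p G) (≈₂app q G)) (sym (pair₂-++ x' y' G)))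

  ε≡pair-εw : ∀ x → ε x ≡ ⟨ x ∣ εw ⟩
  ε≡pair-εw x = trans (sym (Evalℚ¹.evalLin-indicator [] x)) (trans (evalLin-pairing _ x) (pair-cong x indicator[]≗εw))
    where
    indicator[]≗εw : ∀ u → Evalℚ¹.indicator [] u ≡ εw u
    indicator[]≗εw [] = refl
    indicator[]≗εw (_ ∷ _) = refl

  ε-∗ : ∀ x y → ε (x ∗ y) ≡ ε x *ℚ ε y
  ε-∗ x y = begin
    ε (x ∗ y) ≡⟨ ε≡pair-εw (x ∗ y) ⟩
    ⟨ x ∗ y ∣ εw ⟩ ≡⟨ pair-∗ x y εw ⟩
    ⟨ x ∣ (λ u → ⟨ y ∣ (λ v → ∑⧢ u v εw) ⟩) ⟩ ≡⟨ pair-cong x (λ u → trans (pair-cong y (λ v → ∑⧢-εw u v)) (pair-* y (εw u) εw)) ⟩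
    ⟨ x ∣ (λ u → εw u *ℚ ⟨ y ∣ εw ⟩) ⟩ ≡⟨ trans (pair-cong x (λ u → ℚP.*-comm (εw u) ⟨ y ∣ εw ⟩)) (pair-* x ⟨ y ∣ εw ⟩ εw) ⟩
    ⟨ y ∣ εw ⟩ *ℚ ⟨ x ∣ εw ⟩ ≡⟨ ℚP.*-comm ⟨ y ∣ εw ⟩ ⟨ x ∣ εw ⟩ ⟩
    ⟨ x ∣ εw ⟩ *ℚ ⟨ y ∣ εw ⟩ ≡⟨ sym (cong₂ _*ℚ_ (ε≡pair-εw x) (ε≡pair-εw y)) ⟩
    ε x *ℚ ε y ∎

  ∑Δ-*ˡ : ∀ w c (G : Word → Word → ℚ) → ∑Δ w (λ p s → c *ℚ G p s) ≡ c *ℚ ∑Δ w G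
  ∑Δ-*ˡ w c G = trans (sym (∑-deconc w _)) (trans (∑-*ˡ (deconc w) c _) (cong (c *ℚ_) (∑-deconc w G)))

  ∑-∑Δ-swap : ∀ {X : Set} (l : List X) w (H : X → Word → Word → ℚ) →
    ∑ l (λ t → ∑Δ w (H t)) ≡ ∑Δ w (λ p s → ∑ l (λ t → H t p s))
  ∑-∑Δ-swap l w H = trans (∑-cong l (λ t → sym (∑-deconc w (H t))))
    (trans (∑-swap l (deconc w) (λ t p → H t (proj₁ p) (proj₂ p))) (∑-deconc w (λ p s → ∑ l (λ t → H t p s))))

  ∑⧢³ : Word → Word → Word → Word → Word → Word → (Word → Word → ℚ) → ℚ
  ∑⧢³ u1 u2 m1 m2 v1 v2 G = ∑ (qsh u1 m1) (λ t → ∑⧢ t v1 (λ x → ∑ (qsh u2 m2) (λ t' → ∑⧢ t' v2 (λ y → G x y))))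

  ∑⧢²-∑Δ : ∀ u m v G → ∑ (qsh u m) (λ t → ∑⧢ t v (λ w → ∑Δ w G)) ≡
    ∑Δ u (λ u1 u2 → ∑Δ m (λ m1 m2 → ∑Δ v (λ v1 v2 → ∑⧢³ u1 u2 m1 m2 v1 v2 G)))
  ∑⧢²-∑Δ u m v G = begin
    ∑ (qsh u m) (λ t → ∑⧢ t v (λ w → ∑Δ w G)) ≡⟨ ∑-cong (qsh u m) (λ t → ∑Δ-⧢ t v G) ⟩
    ∑ (qsh u m) (λ t → ∑Δ t G') ≡⟨ ∑Δ-⧢ u m G' ⟩
    ∑Δ⧢Δ u m G' ≡⟨ ∑Δ-cong u _ _ (λ u1 u2 → ∑Δ-cong m _ _ (λ m1 m2 → inner u1 u2 m1 m2)) ⟩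
    ∑Δ u (λ u1 u2 → ∑Δ m (λ m1 m2 → ∑Δ v (λ v1 v2 → ∑⧢³ u1 u2 m1 m2 v1 v2 G))) ∎
    where
    G' : Word → Word → ℚ
    G' t1 t2 = ∑Δ v (λ v1 v2 → ∑⧢ t1 v1 (λ x → ∑⧢ t2 v2 (λ y → G x y)))
    inner : ∀ u1 u2 m1 m2 → ∑⧢ u1 m1 (λ x → ∑⧢ u2 m2 (λ y → G' x y)) ≡ ∑Δ v (λ v1 v2 → ∑⧢³ u1 u2 m1 m2 v1 v2 G)
    inner u1 u2 m1 m2 = begin
      ∑⧢ u1 m1 (λ x → ∑⧢ u2 m2 (λ y → G' x y))
        ≡⟨ ∑-cong (qsh u1 m1) (λ x → ∑-∑Δ-swap (qsh u2 m2) v (λ y v1 v2 → ∑⧢ x v1 (λ x' → ∑⧢ y v2 (λ y' → G x' y')))) ⟩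
      ∑ (qsh u1 m1) (λ x → ∑Δ v (λ v1 v2 → ∑ (qsh u2 m2) (λ y → ∑⧢ x v1 (λ x' → ∑⧢ y v2 (λ y' → G x' y')))))
        ≡⟨ ∑-∑Δ-swap (qsh u1 m1) v _ ⟩
      ∑Δ v (λ v1 v2 → ∑ (qsh u1 m1) (λ x → ∑ (qsh u2 m2) (λ y → ∑⧢ x v1 (λ x' → ∑⧢ y v2 (λ y' → G x' y')))))
        ≡⟨ ∑Δ-cong v _ _ (λ v1 v2 → ∑-cong (qsh u1 m1) (λ x → ∑-swap (qsh u2 m2) (qsh x v1) (λ y x' → ∑⧢ y v2 (λ y' → G x' y')))) ⟩
      ∑Δ v (λ v1 v2 → ∑⧢³ u1 u2 m1 m2 v1 v2 G) ∎

  pair-⟪⟫∗⟪⟫∗⟪⟫ : ∀ u m v F → ⟨ (⟪ u ⟫ ∗ ⟪ m ⟫) ∗ ⟪ v ⟫ ∣ F ⟩ ≡ ∑ (qsh u m) (λ t → ∑⧢ t v F)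
  pair-⟪⟫∗⟪⟫∗⟪⟫ u m v F = trans (pair-∗ (⟪ u ⟫ ∗ ⟪ m ⟫) ⟪ v ⟫ F) (trans (pair-cong (⟪ u ⟫ ∗ ⟪ m ⟫) (λ t → pair-⟪⟫ v (λ v' → ∑⧢ t v' F)))
    (pair-⟪⟫∗⟪⟫ u m (λ t → ∑⧢ t v F)))

  Δ∗³ʷ : ℚ → Word → Word → Word → Lin2
  Δ∗³ʷ c u m v = concatMap (λ p → concatMap (λ p' → concatMap (λ p'' →
    scale c ((⟪ proj₁ p ⟫ ∗ ⟪ proj₁ p' ⟫) ∗ ⟪ proj₁ p'' ⟫) ⊗ ((⟪ proj₂ p ⟫ ∗ ⟪ proj₂ p' ⟫) ∗ ⟪ proj₂ p'' ⟫))
    (deconc v)) (deconc m)) (deconc u)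

  pair₂-Δ∗³ʷ : ∀ c u m v G → ⟨ Δ∗³ʷ c u m v ∣ G ⟩₂ ≡ c *ℚ ∑Δ u (λ u1 u2 → ∑Δ m (λ m1 m2 → ∑Δ v (λ v1 v2 → ∑⧢³ u1 u2 m1 m2 v1 v2 G)))
  pair₂-Δ∗³ʷ c u m v G = begin
    ⟨ Δ∗³ʷ c u m v ∣ G ⟩₂ ≡⟨ pair₂-concatMap _ (deconc u) G ⟩
    _ ≡⟨ ∑-cong (deconc u) (λ p → trans (pair₂-concatMap _ (deconc m) G) (∑-cong (deconc m) (λ p' →
          trans (pair₂-concatMap _ (deconc v) G) (∑-cong (deconc v) (λ p'' → pair₂-Δ∗³-summand p p' p''))))) ⟩
    ∑ (deconc u) (λ p → ∑ (deconc m) (λ p' → ∑ (deconc v) (λ p'' →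
      c *ℚ ∑⧢³ (proj₁ p) (proj₂ p) (proj₁ p') (proj₂ p') (proj₁ p'') (proj₂ p'') G)))
      ≡⟨ ∑-cong (deconc u) (λ p → ∑-cong (deconc m) (λ p' →
           trans (∑-deconc v (λ v1 v2 → c *ℚ ∑⧢³ (proj₁ p) (proj₂ p) (proj₁ p') (proj₂ p') v1 v2 G))
                 (∑Δ-*ˡ v c (λ v1 v2 → ∑⧢³ (proj₁ p) (proj₂ p) (proj₁ p') (proj₂ p') v1 v2 G)))) ⟩
    ∑ (deconc u) (λ p → ∑ (deconc m) (λ p' → c *ℚ ∑Δ v (λ v1 v2 → ∑⧢³ (proj₁ p) (proj₂ p) (proj₁ p') (proj₂ p') v1 v2 G)))
      ≡⟨ ∑-cong (deconc u) (λ p → trans (∑-deconc m (λ m1 m2 → c *ℚ ∑Δ v (λ v1 v2 → ∑⧢³ (proj₁ p) (proj₂ p) m1 m2 v1 v2 G)))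
           (∑Δ-*ˡ m c (λ m1 m2 → ∑Δ v (λ v1 v2 → ∑⧢³ (proj₁ p) (proj₂ p) m1 m2 v1 v2 G)))) ⟩
    ∑ (deconc u) (λ p → c *ℚ ∑Δ m (λ m1 m2 → ∑Δ v (λ v1 v2 → ∑⧢³ (proj₁ p) (proj₂ p) m1 m2 v1 v2 G)))
      ≡⟨ trans (∑-deconc u (λ u1 u2 → c *ℚ ∑Δ m (λ m1 m2 → ∑Δ v (λ v1 v2 → ∑⧢³ u1 u2 m1 m2 v1 v2 G))))
               (∑Δ-*ˡ u c (λ u1 u2 → ∑Δ m (λ m1 m2 → ∑Δ v (λ v1 v2 → ∑⧢³ u1 u2 m1 m2 v1 v2 G)))) ⟩
    c *ℚ ∑Δ u (λ u1 u2 → ∑Δ m (λ m1 m2 → ∑Δ v (λ v1 v2 → ∑⧢³ u1 u2 m1 m2 v1 v2 G))) ∎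
    where
    pair₂-Δ∗³-summand : ∀ p p' p'' → ⟨ scale c ((⟪ proj₁ p ⟫ ∗ ⟪ proj₁ p' ⟫) ∗ ⟪ proj₁ p'' ⟫) ⊗ ((⟪ proj₂ p ⟫ ∗ ⟪ proj₂ p' ⟫) ∗ ⟪ proj₂ p'' ⟫) ∣ G ⟩₂
      ≡ c *ℚ ∑⧢³ (proj₁ p) (proj₂ p) (proj₁ p') (proj₂ p') (proj₁ p'') (proj₂ p'') G
    pair₂-Δ∗³-summand (u1 , u2) (m1 , m2) (v1 , v2) = begin
      _ ≡⟨ pair₂-⊗ (scale c ((⟪ u1 ⟫ ∗ ⟪ m1 ⟫) ∗ ⟪ v1 ⟫)) ((⟪ u2 ⟫ ∗ ⟪ m2 ⟫) ∗ ⟪ v2 ⟫) G ⟩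
      _ ≡⟨ pair-scale c ((⟪ u1 ⟫ ∗ ⟪ m1 ⟫) ∗ ⟪ v1 ⟫) _ ⟩
      _ ≡⟨ cong (c *ℚ_) (trans (pair-cong ((⟪ u1 ⟫ ∗ ⟪ m1 ⟫) ∗ ⟪ v1 ⟫) (λ x → pair-⟪⟫∗⟪⟫∗⟪⟫ u2 m2 v2 (λ y → G x y)))
            (pair-⟪⟫∗⟪⟫∗⟪⟫ u1 m1 v1 _)) ⟩
      c *ℚ ∑⧢³ u1 u2 m1 m2 v1 v2 G ∎

  Δ∗³ : Lin → Lin → Lin → Lin2
  Δ∗³ a n b = concatMap (λ s → concatMap (λ m → concatMap (λ r →
    Δ∗³ʷ ((proj₁ s *ℚ proj₁ m) *ℚ proj₁ r) (proj₂ s) (proj₂ m) (proj₂ r)) b) n) a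

  pair₂-Δ∗³ : ∀ a n b G → ⟨ Δ ((a ∗ n) ∗ b) ∣ G ⟩₂ ≡ ⟨ Δ∗³ a n b ∣ G ⟩₂
  pair₂-Δ∗³ a n b G = begin
    ⟨ Δ ((a ∗ n) ∗ b) ∣ G ⟩₂ ≡⟨ pair₂-Δ ((a ∗ n) ∗ b) G ⟩
    ⟨ (a ∗ n) ∗ b ∣ (λ w → ∑Δ w G) ⟩ ≡⟨ pair-∗ (a ∗ n) b _ ⟩
    ⟨ a ∗ n ∣ (λ t → ⟨ b ∣ (λ v → ∑⧢ t v (λ w → ∑Δ w G)) ⟩) ⟩ ≡⟨ pair-∗ a n _ ⟩
    ⟨ a ∣ (λ u → ⟨ n ∣ (λ m → ∑⧢ u m (λ t → ⟨ b ∣ (λ v → ∑⧢ t v (λ w → ∑Δ w G)) ⟩)) ⟩) ⟩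
      ≡⟨ pair-cong a (λ u → pair-cong n (λ m → trans (sym (pair-∑ b (qsh u m) (λ t v → ∑⧢ t v (λ w → ∑Δ w G))))
           (pair-cong b (λ v → ∑⧢²-∑Δ u m v G)))) ⟩
    ⟨ a ∣ (λ u → ⟨ n ∣ (λ m → ⟨ b ∣ (λ v → D u m v) ⟩) ⟩) ⟩
      ≡⟨ ∑-cong a (λ s → trans (sym (∑-*ˡ n (proj₁ s) _)) (∑-cong n (λ m →
           trans (cong (proj₁ s *ℚ_) (sym (∑-*ˡ b (proj₁ m) _))) (trans (sym (∑-*ˡ b (proj₁ s) _))
             (∑-cong b (λ r → step s m r)))))) ⟩
    ∑ a (λ s → ∑ n (λ m → ∑ b (λ r → ⟨ Δ∗³ʷ ((proj₁ s *ℚ proj₁ m) *ℚ proj₁ r) (proj₂ s) (proj₂ m) (proj₂ r) ∣ G ⟩₂)))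
      ≡⟨ sym (trans (pair₂-concatMap _ a G) (∑-cong a (λ s → trans (pair₂-concatMap _ n G) (∑-cong n (λ m → pair₂-concatMap _ b G))))) ⟩
    ⟨ Δ∗³ a n b ∣ G ⟩₂ ∎
    where
    D : Word → Word → Word → ℚ
    D u m v = ∑Δ u (λ u1 u2 → ∑Δ m (λ m1 m2 → ∑Δ v (λ v1 v2 → ∑⧢³ u1 u2 m1 m2 v1 v2 G)))
    step : ∀ (s m r : ℚ × Word) → proj₁ s *ℚ (proj₁ m *ℚ (proj₁ r *ℚ D (proj₂ s) (proj₂ m) (proj₂ r))) ≡
      ⟨ Δ∗³ʷ ((proj₁ s *ℚ proj₁ m) *ℚ proj₁ r) (proj₂ s) (proj₂ m) (proj₂ r) ∣ G ⟩₂
    step (qs , us) (qm , um) (qr , ur) = trans (cong (qs *ℚ_) (sym (ℚP.*-assoc qm qr (D us um ur))))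
      (trans (sym (ℚP.*-assoc qs (qm *ℚ qr) (D us um ur))) (trans (cong (_*ℚ D us um ur) (sym (ℚP.*-assoc qs qm qr)))
      (sym (pair₂-Δ∗³ʷ ((qs *ℚ qm) *ℚ qr) us um ur G))))

  Δ-∗³ : ∀ a n b → Δ ((a ∗ n) ∗ b) ≈₂ Δ∗³ a n b
  Δ-∗³ a n b = mk≈₂ (pair₂-Δ∗³ a n b)

  ≋-trans : ∀ x y z → x ≋ y → y ≋ z → x ≋ z
  ≋-trans x y z p q w = trans (p w) (q w)

  ≋-sym : ∀ x y → x ≋ y → y ≋ x
  ≋-sym x y p w = sym (p w)

  concatMap-map : ∀ {X Y : Set} (f : Y → Lin) (g : X → Y) l → concatMap f (map g l) ≈ concatMap (λ t → f (g t)) l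
  concatMap-map f g l = mk≈ λ F → trans (pair-concatMap f (map g l) F) (trans (∑-map g l _) (sym (pair-concatMap (λ t → f (g t)) l F)))

  concatMap-++ : ∀ {X : Set} (f : X → Lin) l m → concatMap f (l ++ m) ≈ concatMap f l ++ concatMap f m
  concatMap-++ f l m = mk≈ λ F → trans (pair-concatMap f (l ++ m) F) (trans (∑-++ l m _)
    (trans (cong₂ _+ℚ_ (sym (pair-concatMap f l F)) (sym (pair-concatMap f m F))) (sym (pair-++ (concatMap f l) (concatMap f m) F))))

  concatMap2-++ : ∀ {X : Set} (f : X → Lin2) l m → concatMap f (l ++ m) ≈₂ concatMap f l ++ concatMap f m
  concatMap2-++ f l m = mk≈₂ λ G → trans (pair₂-concatMap f (l ++ m) G) (trans (∑-++ l m _)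
    (trans (cong₂ _+ℚ_ (sym (pair₂-concatMap f l G)) (sym (pair₂-concatMap f m G))) (sym (pair₂-++ (concatMap f l) (concatMap f m) G))))

  scale-concatMap : ∀ {X : Set} q (f : X → Lin) l → scale q (concatMap f l) ≈ concatMap (λ t → scale q (f t)) l
  scale-concatMap q f l = mk≈ λ F → trans (pair-scale q (concatMap f l) F) (trans (cong (q *ℚ_) (pair-concatMap f l F))
    (trans (sym (∑-*ˡ l q _)) (trans (∑-cong l (λ t → sym (pair-scale q (f t) F))) (sym (pair-concatMap (λ t → scale q (f t)) l F)))))

  Δ-concatMap : ∀ {X : Set} (f : X → Lin) l → Δ (concatMap f l) ≈₂ concatMap (λ t → Δ (f t)) l
  Δ-concatMap f l = mk≈₂ λ G → trans (pair₂-Δ (concatMap f l) G) (trans (pair-concatMap f l _)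
    (trans (∑-cong l (λ t → sym (pair₂-Δ (f t) G))) (sym (pair₂-concatMap (λ t → Δ (f t)) l G))))

  InN-⟪⟫ : ∀ m → NonSingular m → InN ⟪ m ⟫
  InN-⟪⟫ m ns = ⟪ m ⟫ , ns ∷ [] , λ w → refl

  Inℐ-generator : ∀ x a n b → InN n → x ≈ (a ∗ n) ∗ b → Inℐ x
  Inℐ-generator x a n b nn p = ((a , n , b) ∷ []) , nn ∷ [] , ≈→≋ {x} {idealSum ((a , n , b) ∷ [])} (≈-trans p (≈-sym
      (++-identityʳ ((a ∗ n) ∗ b))))

  InN→Inℐ : ∀ x → InN x → Inℐ x
  InN→Inℐ x nn = Inℐ-generator x 𝟙 x 𝟙 nn (≈-sym (≈-trans (∗-identityʳ (𝟙 ∗ x)) (∗-identityˡ x)))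

  Inℐ-≋ : ∀ x y → x ≋ y → Inℐ x → Inℐ y
  Inℐ-≋ x y p (L , a , q) = L , a , ≋-trans y x (idealSum L) (≋-sym x y p) q

  Inℐ-≈ : ∀ x y → x ≈ y → Inℐ x → Inℐ y
  Inℐ-≈ x y p = Inℐ-≋ x y (≈→≋ p)

  Inℐ-[] : Inℐ []
  Inℐ-[] = [] , [] , λ w → refl

  Inℐ-++ : ∀ x y → Inℐ x → Inℐ y → Inℐ (x ++ y)
  Inℐ-++ x y (L , a , p) (M , b , q) = (L ++ M) , ++⁺ a b ,
    ≈→≋ {x ++ y} {idealSum (L ++ M)} (≈-trans (++-cong {x} {idealSum L} {y} {idealSum M} (≋→≈ {x} {idealSum L} p) (≋→≈ {y}
        {idealSum M} q)) (≈-sym (concatMap-++ _ L M)))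

  Inℐ-scale : ∀ q x → Inℐ x → Inℐ (scale q x)
  Inℐ-scale q x (L , a , p) = map g L , gmap⁺ (λ z → z) a ,
    ≈→≋ {scale q x} {idealSum (map g L)} (≈-trans (scale-cong q (≋→≈ {x} {idealSum L} p)) (≈-trans (scale-concatMap q _ L)
        (≈-trans (concatMap-cong L h) (≈-sym (concatMap-map _ g L)))))
    where
    g : Lin × Lin × Lin → Lin × Lin × Lin
    g t = (scale q (proj₁ t) , proj₂ t)
    h : ∀ t → scale q ((proj₁ t ∗ proj₁ (proj₂ t)) ∗ proj₂ (proj₂ t)) ≈ (scale q (proj₁ t) ∗ proj₁ (proj₂ t)) ∗ proj₂ (proj₂ t)
    h (a , n , b) = ≈-sym (≈-trans (∗-congˡ b (∗-scaleˡ q a n)) (∗-scaleˡ q (a ∗ n) b))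

  Inℐ-∗ˡ : ∀ h x → Inℐ x → Inℐ (h ∗ x)
  Inℐ-∗ˡ h x (L , a , p) = map g L , gmap⁺ (λ z → z) a ,
    ≈→≋ {h ∗ x} {idealSum (map g L)} (≈-trans (∗-congʳ h (≋→≈ {x} {idealSum L} p)) (≈-trans (∗-concatMapʳ h _ L) (≈-trans
        (concatMap-cong L k) (≈-sym (concatMap-map _ g L)))))
    where
    g : Lin × Lin × Lin → Lin × Lin × Lin
    g t = (h ∗ proj₁ t , proj₂ t)
    k : ∀ t → h ∗ ((proj₁ t ∗ proj₁ (proj₂ t)) ∗ proj₂ (proj₂ t)) ≈ ((h ∗ proj₁ t) ∗ proj₁ (proj₂ t)) ∗ proj₂ (proj₂ t)
    k (a , n , b) = ≈-sym (≈-trans (∗-assoc (h ∗ a) n b) (≈-trans (∗-assoc h a (n ∗ b))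
      (∗-congʳ h (≈-sym (∗-assoc a n b)))))

  Inℐ-∗ʳ : ∀ h x → Inℐ x → Inℐ (x ∗ h)
  Inℐ-∗ʳ h x (L , a , p) = map g L , gmap⁺ (λ z → z) a ,
    ≈→≋ {x ∗ h} {idealSum (map g L)} (≈-trans (∗-congˡ h (≋→≈ {x} {idealSum L} p)) (≈-trans (∗-concatMapˡ _ L h) (≈-trans
        (concatMap-cong L k) (≈-sym (concatMap-map _ g L)))))
    where
    g : Lin × Lin × Lin → Lin × Lin × Lin
    g t = (proj₁ t , proj₁ (proj₂ t) , proj₂ (proj₂ t) ∗ h)
    k : ∀ t → ((proj₁ t ∗ proj₁ (proj₂ t)) ∗ proj₂ (proj₂ t)) ∗ h ≈ (proj₁ t ∗ proj₁ (proj₂ t)) ∗ (proj₂ (proj₂ t) ∗ h)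
    k (a , n , b) = ∗-assoc (a ∗ n) b h

  ε-InN : ∀ x → InN x → ε x ≡ 0ℚ
  ε-InN x (L , a , p) = trans (p []) (go L a)
    where
    go : ∀ L → All (λ t → NonSingular (proj₂ t)) L → coeff L [] ≡ 0ℚ
    go [] [] = refl
    go ((q , []) ∷ L) (() ∷ _)
    go ((q , k ∷ u) ∷ L) (_ ∷ a) = trans (coeff-no q (k ∷ u) [] L (λ ())) (go L a)

  ε-Inℐ : ∀ x → Inℐ x → ε x ≡ 0ℚ
  ε-Inℐ x (L , a , p) = trans (p []) (trans (ε≡pair-εw (idealSum L)) (trans (pair-concatMap _ L εw) (∑-zero-All a (λ {t} → go {t}))))
    where
    go : ∀ {t : Lin × Lin × Lin} → InN (proj₁ (proj₂ t)) → ⟨ (proj₁ t ∗ proj₁ (proj₂ t)) ∗ proj₂ (proj₂ t) ∣ εw ⟩ ≡ 0ℚ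
    go {a' , n , b} nn = trans (sym (ε≡pair-εw ((a' ∗ n) ∗ b))) (trans (ε-∗ (a' ∗ n) b) (trans (cong (_*ℚ ε b) (ε-∗ a' n))
      (trans (cong (λ z → (ε a' *ℚ z) *ℚ ε b) (ε-InN n nn)) (trans (cong (_*ℚ ε b) (ℚP.*-zeroʳ (ε a'))) (ℚP.*-zeroˡ (ε b))))))

  -- 𝒩 is a coideal

  summandInI : (Lin × Lin) ⊎ (Lin × Lin) → Set
  summandInI (inj₁ (a , h)) = Inℐ a
  summandInI (inj₂ (h , a)) = Inℐ a

  summand : (Lin × Lin) ⊎ (Lin × Lin) → Lin2
  summand (inj₁ (a , h)) = a ⊗ h
  summand (inj₂ (h , a)) = h ⊗ a

  -- In-I⊗H+H⊗I Inℐ, with the summand functions (local to its definition in Defs) made nameable.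
  In𝒩₂ : Lin2 → Set
  In𝒩₂ z = Σ (List ((Lin × Lin) ⊎ (Lin × Lin))) (λ L → All summandInI L × z ≋₂ concatMap summand L)

  In𝒩₂→In-I⊗H+H⊗I : ∀ z → In𝒩₂ z → In-I⊗H+H⊗I Inℐ z
  In𝒩₂→In-I⊗H+H⊗I z (L , a , p) = L , All.map (λ { {inj₁ _} x → x ; {inj₂ _} x → x }) a ,
    λ u v → trans (p u v) (cong (λ y → coeff2 y u v) (LP.concatMap-cong {f = summand} (λ { (inj₁ _) → refl ; (inj₂ _) → refl }) L))

  In𝒩₂-≈₂ : ∀ z z' → z ≈₂ z' → In𝒩₂ z → In𝒩₂ z'
  In𝒩₂-≈₂ z z' p (L , a , q) = L , a , λ u v → trans (sym (≈₂→≋₂ {z} {z'} p u v)) (q u v)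

  In𝒩₂-[] : In𝒩₂ []
  In𝒩₂-[] = [] , [] , λ u v → refl

  In𝒩₂-++ : ∀ z z' → In𝒩₂ z → In𝒩₂ z' → In𝒩₂ (z ++ z')
  In𝒩₂-++ z z' (L , a , p) (M , b , q) = (L ++ M) , ++⁺ a b ,
    ≈₂→≋₂ {z ++ z'} {concatMap summand (L ++ M)} (≈₂-trans (++₂-cong {z} {concatMap summand L} {z'} {concatMap summand M}
       (≋₂→≈₂ {z} {concatMap summand L} p) (≋₂→≈₂ {z'} {concatMap summand M} q)) (≈₂-sym (concatMap2-++ summand L M)))

  In𝒩₂-concatMapAll : ∀ {X : Set} (f : X → Lin2) {P : X → Set} → (∀ {t} → P t → In𝒩₂ (f t)) → ∀ l → All P l → In𝒩₂ (concatMap f l)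
  In𝒩₂-concatMapAll f h [] [] = In𝒩₂-[]
  In𝒩₂-concatMapAll f h (t ∷ l) (p ∷ ps) = In𝒩₂-++ (f t) (concatMap f l) (h p) (In𝒩₂-concatMapAll f h l ps)

  In𝒩₂-concatMap : ∀ {X : Set} (f : X → Lin2) → (∀ t → In𝒩₂ (f t)) → ∀ l → In𝒩₂ (concatMap f l)
  In𝒩₂-concatMap f h [] = In𝒩₂-[]
  In𝒩₂-concatMap f h (t ∷ l) = In𝒩₂-++ (f t) (concatMap f l) (h t) (In𝒩₂-concatMap f h l)

  In𝒩₂-𝒩⊗H : ∀ X Y → Inℐ X → In𝒩₂ (X ⊗ Y)
  In𝒩₂-𝒩⊗H X Y i = (inj₁ (X , Y) ∷ []) , i ∷ [] , λ u v → cong (λ z → coeff2 z u v) (sym (LP.++-identityʳ (X ⊗ Y)))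

  In𝒩₂-H⊗𝒩 : ∀ X Y → Inℐ Y → In𝒩₂ (X ⊗ Y)
  In𝒩₂-H⊗𝒩 X Y i = (inj₂ (X , Y) ∷ []) , i ∷ [] , λ u v → cong (λ z → coeff2 z u v) (sym (LP.++-identityʳ (X ⊗ Y)))

  deconc-All : ∀ w → All (λ p → proj₁ p ++ proj₂ p ≡ w) (deconc w)
  deconc-All [] = refl ∷ []
  deconc-All (a ∷ w) = refl ∷ gmap⁺ (λ eq → cong (a ∷_) eq) (deconc-All w)

  PartialOK-prefix : ∀ j s r t → PartialOK j s (r ++ t) → PartialOK j s r
  PartialOK-prefix j s [] t _ = tt
  PartialOK-prefix j s (k ∷ r) t (x , y) = x , PartialOK-prefix _ _ r t y

  NonSingular-prefix : ∀ k r s → NonSingular (k ∷ r ++ s) → NonSingular (k ∷ r)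
  NonSingular-prefix k [] [] ns = ns
  NonSingular-prefix k [] (k2 ∷ s) ns = proj₁ ns
  NonSingular-prefix k (k2 ∷ r) s (x , y , z) = x , y , PartialOK-prefix 3 _ r s z

  In𝒩₂-Δ∗³-summand : ∀ c (p p' p'' : Word × Word) m → NonSingular m → proj₁ p' ++ proj₂ p' ≡ m →
    In𝒩₂ (scale c ((⟪ proj₁ p ⟫ ∗ ⟪ proj₁ p' ⟫) ∗ ⟪ proj₁ p'' ⟫) ⊗ ((⟪ proj₂ p ⟫ ∗ ⟪ proj₂ p' ⟫) ∗ ⟪ proj₂ p'' ⟫))
  In𝒩₂-Δ∗³-summand c (u1 , u2) ([] , m2) (v1 , v2) m ns refl =
    In𝒩₂-H⊗𝒩 (scale c ((⟪ u1 ⟫ ∗ ⟪ [] ⟫) ∗ ⟪ v1 ⟫)) ((⟪ u2 ⟫ ∗ ⟪ m2 ⟫) ∗ ⟪ v2 ⟫) (Inℐ-generator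
        ((⟪ u2 ⟫ ∗ ⟪ m2 ⟫) ∗ ⟪ v2 ⟫) ⟪ u2 ⟫ ⟪ m2 ⟫ ⟪ v2 ⟫ (InN-⟪⟫ m2 ns) ≈-refl)
  In𝒩₂-Δ∗³-summand c (u1 , u2) (k ∷ r , m2) (v1 , v2) m ns refl =
    In𝒩₂-𝒩⊗H (scale c ((⟪ u1 ⟫ ∗ ⟪ k ∷ r ⟫) ∗ ⟪ v1 ⟫)) ((⟪ u2 ⟫ ∗ ⟪ m2 ⟫) ∗ ⟪ v2 ⟫) (Inℐ-generator (scale c
        ((⟪ u1 ⟫ ∗ ⟪ k ∷ r ⟫) ∗ ⟪ v1 ⟫)) (scale c ⟪ u1 ⟫) ⟪ k ∷ r ⟫ ⟪ v1 ⟫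
      (InN-⟪⟫ (k ∷ r) (NonSingular-prefix k r m2 ns))
      (≈-sym (≈-trans (∗-congˡ ⟪ v1 ⟫ (∗-scaleˡ c ⟪ u1 ⟫ ⟪ k ∷ r ⟫)) (∗-scaleˡ c (⟪ u1 ⟫ ∗ ⟪ k ∷ r ⟫) ⟪ v1 ⟫))))

  In𝒩₂-Δ∗³ʷ : ∀ c u m v → NonSingular m → In𝒩₂ (Δ∗³ʷ c u m v)
  In𝒩₂-Δ∗³ʷ c u m v ns = In𝒩₂-concatMap _ (λ p → In𝒩₂-concatMapAll _ (λ {p'} eq → In𝒩₂-concatMap _
      (λ p'' → In𝒩₂-Δ∗³-summand c p p' p'' m ns eq) (deconc v))
    (deconc m) (deconc-All m)) (deconc u)

  In𝒩₂-Δ∗³ : ∀ a n b → All (λ t → NonSingular (proj₂ t)) n → In𝒩₂ (Δ∗³ a n b)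
  In𝒩₂-Δ∗³ a n b alln = In𝒩₂-concatMap _ (λ s → In𝒩₂-concatMapAll _ (λ {m} ns → In𝒩₂-concatMap _
    (λ r → In𝒩₂-Δ∗³ʷ ((proj₁ s *ℚ proj₁ m) *ℚ proj₁ r) (proj₂ s) (proj₂ m) (proj₂ r) ns) b) n alln) a

  In𝒩₂-Δ : ∀ x → Inℐ x → In𝒩₂ (Δ x)
  In𝒩₂-Δ x (L , allL , p) =
    In𝒩₂-≈₂ _ _ (≈₂-sym (≈₂-trans (Δ-cong (≋→≈ {x} {idealSum L} p)) (Δ-concatMap _ L)))
      (In𝒩₂-concatMapAll _ (λ {t} nn → one t nn) L allL)
    where
    one : ∀ (t : Lin × Lin × Lin) → InN (proj₁ (proj₂ t)) → In𝒩₂ (Δ ((proj₁ t ∗ proj₁ (proj₂ t)) ∗ proj₂ (proj₂ t)))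
    one (a , n , b) (n' , alln , q) = In𝒩₂-≈₂ _ _
      (≈₂-sym (≈₂-trans (Δ-cong (∗-congˡ b (∗-congʳ a (≋→≈ {n} {n'} q)))) (Δ-∗³ a n' b))) (In𝒩₂-Δ∗³ a n' b alln)

  Inℐ-Δ-closed : ∀ x → Inℐ x → In-I⊗H+H⊗I Inℐ (Δ x)
  Inℐ-Δ-closed x i = In𝒩₂→In-I⊗H+H⊗I (Δ x) (In𝒩₂-Δ x i)

  Δ∗Δ-summand : ℚ → Word × Word → Word × Word → Lin2
  Δ∗Δ-summand c p r = scale c (⟪ proj₁ p ⟫ ∗ ⟪ proj₁ r ⟫) ⊗ (⟪ proj₂ p ⟫ ∗ ⟪ proj₂ r ⟫)

  Δ∗Δ : Lin → Lin → Lin2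
  Δ∗Δ x y = concatMap (λ s → concatMap (λ p → concatMap (λ t → concatMap (λ r →
    Δ∗Δ-summand (proj₁ s *ℚ proj₁ t) p r) (deconc (proj₂ t))) y) (deconc (proj₂ s))) x

  pair₂-Δ∗Δ-summand : ∀ c p r G → ⟨ Δ∗Δ-summand c p r ∣ G ⟩₂ ≡ c *ℚ ∑⧢ (proj₁ p) (proj₁ r) (λ a → ∑⧢ (proj₂ p) (proj₂ r) (λ b → G a b))
  pair₂-Δ∗Δ-summand c (p1 , p2) (r1 , r2) G = trans (pair₂-⊗ (scale c (⟪ p1 ⟫ ∗ ⟪ r1 ⟫)) (⟪ p2 ⟫ ∗ ⟪ r2 ⟫) G)
    (trans (pair-scale c (⟪ p1 ⟫ ∗ ⟪ r1 ⟫) _) (cong (c *ℚ_) (trans (pair-cong (⟪ p1 ⟫ ∗ ⟪ r1 ⟫) (λ a → pair-⟪⟫∗⟪⟫ p2 r2 (λ b → G a b)))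
      (pair-⟪⟫∗⟪⟫ p1 r1 (λ a → ∑⧢ p2 r2 (λ b → G a b))))))

  pair₂-Δ-∗ : ∀ x y G → ⟨ Δ (x ∗ y) ∣ G ⟩₂ ≡ ⟨ Δ∗Δ x y ∣ G ⟩₂
  pair₂-Δ-∗ x y G = begin
    ⟨ Δ (x ∗ y) ∣ G ⟩₂ ≡⟨ pair₂-Δ (x ∗ y) G ⟩
    ⟨ x ∗ y ∣ (λ w → ∑Δ w G) ⟩ ≡⟨ pair-∗ x y _ ⟩
    ⟨ x ∣ (λ u → ⟨ y ∣ (λ v → ∑⧢ u v (λ w → ∑Δ w G)) ⟩) ⟩ ≡⟨ pair-cong x (λ u → pair-cong y (λ v → ∑Δ-⧢ u v G)) ⟩
    ⟨ x ∣ (λ u → ⟨ y ∣ (λ v → ∑Δ⧢Δ u v G) ⟩) ⟩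
      ≡⟨ ∑-cong x inner ⟩
    ∑ x (λ s → ∑ (deconc (proj₂ s)) (λ p → ∑ y (λ t → ∑ (deconc (proj₂ t)) (λ r →
      ⟨ Δ∗Δ-summand (proj₁ s *ℚ proj₁ t) p r ∣ G ⟩₂))))
      ≡⟨ sym (trans (pair₂-concatMap _ x G) (∑-cong x (λ s → trans (pair₂-concatMap _ (deconc (proj₂ s)) G)
           (∑-cong (deconc (proj₂ s)) (λ p → trans (pair₂-concatMap _ y G) (∑-cong y (λ t → pair₂-concatMap _ (deconc (proj₂ t)) G))))))) ⟩
    ⟨ Δ∗Δ x y ∣ G ⟩₂ ∎
    where
    K : Word → Word → Word → Word → ℚ
    K p1 p2 r1 r2 = ∑⧢ p1 r1 (λ a → ∑⧢ p2 r2 (λ b → G a b))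
    step : ∀ (s : ℚ × Word) (p : Word × Word) (t : ℚ × Word) →
      proj₁ s *ℚ (proj₁ t *ℚ ∑Δ (proj₂ t) (λ r1 r2 → K (proj₁ p) (proj₂ p) r1 r2)) ≡
      ∑ (deconc (proj₂ t)) (λ r → ⟨ Δ∗Δ-summand (proj₁ s *ℚ proj₁ t) p r ∣ G ⟩₂)
    step (qs , us) p (qt , vt) = trans (sym (ℚP.*-assoc qs qt _)) (trans (cong ((qs *ℚ qt) *ℚ_) (sym (∑-deconc vt _)))
      (trans (sym (∑-*ˡ (deconc vt) (qs *ℚ qt) _)) (∑-cong (deconc vt) (λ r → sym (pair₂-Δ∗Δ-summand (qs *ℚ qt) p r G)))))
    inner : ∀ (s : ℚ × Word) → proj₁ s *ℚ ⟨ y ∣ (λ v → ∑Δ⧢Δ (proj₂ s) v G) ⟩ ≡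
      ∑ (deconc (proj₂ s)) (λ p → ∑ y (λ t → ∑ (deconc (proj₂ t)) (λ r → ⟨ Δ∗Δ-summand (proj₁ s *ℚ proj₁ t) p r ∣ G ⟩₂)))
    inner (qs , us) = trans (cong (qs *ℚ_) A) (trans (sym (∑-*ˡ (deconc us) qs _)) (∑-cong (deconc us) (λ p →
        trans (sym (∑-*ˡ y qs _)) (∑-cong y (λ t → step (qs , us) p t)))))
      where
      A : ⟨ y ∣ (λ v → ∑Δ⧢Δ us v G) ⟩ ≡ ∑ (deconc us) (λ p → ∑ y (λ t → proj₁ t *ℚ ∑Δ (proj₂ t) (λ r1 r2 → K (proj₁ p) (proj₂ p) r1 r2)))
      A = trans (∑-cong y (λ t → trans (cong (proj₁ t *ℚ_) (sym (∑-deconc us (λ p1 p2 → ∑Δ (proj₂ t) (λ r1 r2 → K p1 p2 r1 r2)))))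
            (sym (∑-*ˡ (deconc us) (proj₁ t) _))))
          (∑-swap y (deconc us) (λ t p → proj₁ t *ℚ ∑Δ (proj₂ t) (λ r1 r2 → K (proj₁ p) (proj₂ p) r1 r2)))

  Δ-∗ : ∀ x y → Δ (x ∗ y) ≈₂ Δ∗Δ x y
  Δ-∗ x y = mk≈₂ (pair₂-Δ-∗ x y)

  LinSetoid : Setoid 0ℓ 0ℓ
  LinSetoid = record { Carrier = Lin ; _≈_ = _≈_ ; isEquivalence = record { refl = ≈-refl ; sym = ≈-sym ; trans = ≈-trans } }

module _ where
  open import Relation.Binary.Reasoning.Setoid LinSetoid
  open import Algebra.Properties.Group ℚP.+-0-group using (∙-cancelʳ; inverseˡ-unique)

  ≡→≈ : ∀ {x y} → x ≡ y → x ≈ y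
  ≡→≈ refl = ≈-refl

  pair-scale-𝟙 : ∀ q F → ⟨ scale q 𝟙 ∣ F ⟩ ≡ q *ℚ F []
  pair-scale-𝟙 q F = trans (pair-scale q 𝟙 F) (cong (q *ℚ_) (pair-𝟙 F))

  ε-word : ∀ w → ε ⟪ w ⟫ ≡ εw w
  ε-word [] = trans (coeff-yes 1ℚ [] []) (ℚP.+-identityʳ 1ℚ)
  ε-word (k ∷ w) = coeff-no 1ℚ (k ∷ w) [] [] (λ ())

  ++≈[]⇒≈neg : ∀ x r → x ++ r ≈ [] → x ≈ neg r
  ++≈[]⇒≈neg x r p = mk≈ λ F →
    trans (inverseˡ-unique ⟨ x ∣ F ⟩ ⟨ r ∣ F ⟩ (trans (sym (pair-++ x r F)) (≈app p F))) (sym (pair-neg r F))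

  ++-cancelʳ : ∀ x x' r r' → x ++ r ≈ x' ++ r' → r ≈ r' → x ≈ x'
  ++-cancelʳ x x' r r' p q = mk≈ λ F → ∙-cancelʳ ⟨ r ∣ F ⟩ ⟨ x ∣ F ⟩ ⟨ x' ∣ F ⟩
    (trans (sym (pair-++ x r F)) (trans (≈app p F) (trans (pair-++ x' r' F) (cong (⟨ x' ∣ F ⟩ +ℚ_) (sym (≈app q F))))))

  concatMap-congAll : ∀ {X : Set} (f g : X → Lin) l → All (λ t → f t ≈ g t) l → concatMap f l ≈ concatMap g l
  concatMap-congAll f g [] [] = ≈-refl
  concatMap-congAll f g (t ∷ l) (p ∷ ps) = ++-cong p (concatMap-congAll f g l ps)

  Inℐ-concatMapAll : ∀ {X : Set} (f : X → Lin) {P : X → Set} → (∀ {t} → P t → Inℐ (f t)) → ∀ l → All P l → Inℐ (concatMap f l)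
  Inℐ-concatMapAll f h [] [] = Inℐ-[]
  Inℐ-concatMapAll f h (t ∷ l) (p ∷ ps) = Inℐ-++ (f t) (concatMap f l) (h p) (Inℐ-concatMapAll f h l ps)

  properDeconc : Word → List (Word × Word)
  properDeconc [] = []
  properDeconc (a ∷ w) = map (λ p → (a ∷ proj₁ p , proj₂ p)) (deconc w)

  deconc-properDeconc : ∀ w → deconc w ≡ ([] , w) ∷ properDeconc w
  deconc-properDeconc [] = refl
  deconc-properDeconc (a ∷ w) = refl

  deconc-length : ∀ w → All (λ p → length (proj₂ p) ≤ length w) (deconc w)
  deconc-length w = All.map (λ {p} eq → subst (λ z → length (proj₂ p) ≤ length z) eq (LP.length-++-≤ʳ (proj₂ p) {proj₁ p})) (deconc-All w)

  properDeconc-length : ∀ w → All (λ p → length (proj₂ p) < length w) (properDeconc w)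
  properDeconc-length [] = []
  properDeconc-length (a ∷ w) = gmap⁺ (λ le → s≤s le) (deconc-length w)

  -- Antipodes preserve 𝒩

  IsRightAntipode : (Word → Lin) → Set
  IsRightAntipode S = ∀ w → concatMap (λ p → ⟪ proj₁ p ⟫ ∗ S (proj₂ p)) (deconc w) ≈ scale (εw w) 𝟙

  IsAntipode→IsRightAntipode : ∀ S → IsAntipode S → IsRightAntipode S
  IsAntipode→IsRightAntipode S h w = ≈-trans (≋→≈ {concatMap (λ p → ⟪ proj₁ p ⟫ ∗ S (proj₂ p)) (deconc w)} {scale (ε ⟪ w ⟫) 𝟙}
      (proj₂ (h w)))
    (≡→≈ (cong (λ q → scale q 𝟙) (ε-word w)))

  -- S w = − Σ_{uv = w, u ≠ []} u ∗ S v, and every nonempty prefix u of a non-singular w is non-singular.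
  rightAntipode-NonSingular : ∀ S → IsRightAntipode S → ∀ w → NonSingular w → Inℐ (S w)
  rightAntipode-NonSingular S ra (k ∷ w) ns = Inℐ-≈ (neg R) (S (k ∷ w)) (≈-sym eq) (Inℐ-scale (-ℚ 1ℚ) R iR)
    where
    R : Lin
    R = concatMap (λ p → ⟪ k ∷ proj₁ p ⟫ ∗ S (proj₂ p)) (deconc w)
    iR : Inℐ R
    iR = Inℐ-concatMapAll (λ p → ⟪ k ∷ proj₁ p ⟫ ∗ S (proj₂ p))
           (λ {p} eq → Inℐ-∗ʳ (S (proj₂ p)) ⟪ k ∷ proj₁ p ⟫ (InN→Inℐ ⟪ k ∷ proj₁ p ⟫ (InN-⟪⟫ (k ∷ proj₁ p)
              (NonSingular-prefix k (proj₁ p) (proj₂ p) (subst (λ z → NonSingular (k ∷ z)) (sym eq) ns)))))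
           (deconc w) (deconc-All w)
    eq0 : (⟪ [] ⟫ ∗ S (k ∷ w)) ++ R ≈ []
    eq0 = ≈-trans (++-cong (≈-refl {⟪ [] ⟫ ∗ S (k ∷ w)}) (≈-sym (concatMap-map (λ p → ⟪ proj₁ p ⟫ ∗ S (proj₂ p)) (λ p →
        (k ∷ proj₁ p , proj₂ p)) (deconc w))))
            (≈-trans (ra (k ∷ w)) (mk≈ λ F → trans (pair-scale-𝟙 0ℚ F) (ℚP.*-zeroˡ (F []))))
    eq : S (k ∷ w) ≈ neg R
    eq = ≈-trans (≈-sym (∗-identityˡ (S (k ∷ w)))) (++≈[]⇒≈neg (⟪ [] ⟫ ∗ S (k ∷ w)) R eq0)

  -- conv₂ Z is the convolution on H ⊗ H of the product u ⊗ v ↦ u ∗ v with Z. For an antipode S, both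
  -- S (u ∗ v) and S v ∗ S u are right inverses of the product in this sense, and such an inverse is unique.
  conv₂ : (Word → Word → Lin) → Word → Word → Lin
  conv₂ Z u v = concatMap (λ p → concatMap (λ r → (⟪ proj₁ p ⟫ ∗ ⟪ proj₁ r ⟫) ∗ Z (proj₂ p) (proj₂ r)) (deconc v)) (deconc u)

  IsConv₂Unit : (Word → Word → Lin) → Set
  IsConv₂Unit Z = ∀ u v → conv₂ Z u v ≈ scale (εw u *ℚ εw v) 𝟙

  conv₂-restˡ conv₂-restʳ : (Word → Word → Lin) → Word → Word → Lin
  conv₂-restˡ Z u v = concatMap (λ r → (⟪ [] ⟫ ∗ ⟪ proj₁ r ⟫) ∗ Z u (proj₂ r)) (properDeconc v)
  conv₂-restʳ Z u v = concatMap (λ p → concatMap (λ r → (⟪ proj₁ p ⟫ ∗ ⟪ proj₁ r ⟫) ∗ Z (proj₂ p) (proj₂ r)) (deconc v)) (properDeconc u)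

  𝟙∗𝟙∗-identity : ∀ x → (⟪ [] ⟫ ∗ ⟪ [] ⟫) ∗ x ≈ x
  𝟙∗𝟙∗-identity x = ≈-trans (∗-congˡ x (∗-identityˡ 𝟙)) (∗-identityˡ x)

  conv₂-split : ∀ Z u v → conv₂ Z u v ≈ Z u v ++ (conv₂-restˡ Z u v ++ conv₂-restʳ Z u v)
  conv₂-split Z u v = begin
    conv₂ Z u v ≡⟨ cong (concatMap f) (deconc-properDeconc u) ⟩
    concatMap (g u) (deconc v) ++ conv₂-restʳ Z u v ≡⟨ cong (λ l → concatMap (g u) l ++ conv₂-restʳ Z u v) (deconc-properDeconc v) ⟩
    (((⟪ [] ⟫ ∗ ⟪ [] ⟫) ∗ Z u v) ++ conv₂-restˡ Z u v) ++ conv₂-restʳ Z u v ≈⟨ ++-assoc ((⟪ [] ⟫ ∗ ⟪ [] ⟫) ∗ Z u v)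
        (conv₂-restˡ Z u v) (conv₂-restʳ Z u v) ⟩
    ((⟪ [] ⟫ ∗ ⟪ [] ⟫) ∗ Z u v) ++ (conv₂-restˡ Z u v ++ conv₂-restʳ Z u v) ≈⟨ ++-cong (𝟙∗𝟙∗-identity (Z u v)) (≈-refl
        {conv₂-restˡ Z u v ++ conv₂-restʳ Z u v}) ⟩
    Z u v ++ (conv₂-restˡ Z u v ++ conv₂-restʳ Z u v) ∎
    where
    g : Word → Word × Word → Lin
    g s r = (⟪ [] ⟫ ∗ ⟪ proj₁ r ⟫) ∗ Z s (proj₂ r)
    f : Word × Word → Lin
    f p = concatMap (λ r → (⟪ proj₁ p ⟫ ∗ ⟪ proj₁ r ⟫) ∗ Z (proj₂ p) (proj₂ r)) (deconc v)

  conv₂-unit-unique : ∀ Z Z' → IsConv₂Unit Z → IsConv₂Unit Z' → ∀ u v → Z u v ≈ Z' u v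
  conv₂-unit-unique Z Z' RZ RZ' u v = go (suc (length u +ℕ length v)) u v ℕP.≤-refl
    where
    go : ∀ n u v → length u +ℕ length v < n → Z u v ≈ Z' u v
    go zero u v ()
    go (suc n) u v (s≤s le) = ++-cancelʳ (Z u v) (Z' u v) (conv₂-restˡ Z u v ++ conv₂-restʳ Z u v)
        (conv₂-restˡ Z' u v ++ conv₂-restʳ Z' u v)
        (≈-trans (≈-sym (conv₂-split Z u v)) (≈-trans (RZ u v) (≈-trans (≈-sym (RZ' u v)) (conv₂-split Z' u v))))
        (++-cong eA eB)
      where
      eA : conv₂-restˡ Z u v ≈ conv₂-restˡ Z' u v
      eA = concatMap-congAll _ _ (properDeconc v) (All.map (λ {r} lt → ∗-congʳ (⟪ [] ⟫ ∗ ⟪ proj₁ r ⟫)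
             (go n u (proj₂ r) (ℕP.<-≤-trans (ℕP.+-monoʳ-< (length u) lt) le))) (properDeconc-length v))
      eB : conv₂-restʳ Z u v ≈ conv₂-restʳ Z' u v
      eB = concatMap-congAll _ _ (properDeconc u) (All.map (λ {p} lt → concatMap-congAll _ _ (deconc v)
             (All.map (λ {r} le' → ∗-congʳ (⟪ proj₁ p ⟫ ∗ ⟪ proj₁ r ⟫)
                (go n (proj₂ p) (proj₂ r) (ℕP.<-≤-trans (ℕP.+-mono-<-≤ lt le') le))) (deconc-length v))) (properDeconc-length u))

  pair-conv₂ : ∀ Z u v F → ⟨ conv₂ Z u v ∣ F ⟩ ≡ ∑Δ u (λ p1 p2 → ∑Δ v (λ r1 r2 → ⟨ (⟪ p1 ⟫ ∗ ⟪ r1 ⟫) ∗ Z p2 r2 ∣ F ⟩))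
  pair-conv₂ Z u v F = trans (pair-concatMap _ (deconc u) F)
    (trans (∑-cong (deconc u) (λ p → trans (pair-concatMap _ (deconc v) F) (∑-deconc v (λ r1 r2 → ⟨ (⟪ proj₁ p ⟫ ∗ ⟪ r1 ⟫) ∗ Z
        (proj₂ p) r2 ∣ F ⟩))))
    (∑-deconc u (λ p1 p2 → ∑Δ v (λ r1 r2 → ⟨ (⟪ p1 ⟫ ∗ ⟪ r1 ⟫) ∗ Z p2 r2 ∣ F ⟩))))

  module RightAntipode (S : Word → Lin) (ra : IsRightAntipode S) where

    X Y : Word → Word → Lin
    X u v = linExt S (⟪ u ⟫ ∗ ⟪ v ⟫)
    Y u v = S v ∗ S u

    module _ (u v : Word) (F : Word → ℚ) where
      G : Word → Word → ℚ
      G x t = ⟨ S t ∣ (λ y → ∑⧢ x y F) ⟩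

      pair-conv₂-X-summand : ∀ p1 p2 r1 r2 → ⟨ (⟪ p1 ⟫ ∗ ⟪ r1 ⟫) ∗ X p2 r2 ∣ F ⟩ ≡ ∑⧢ p1 r1 (λ x → ∑⧢ p2 r2 (λ y → G x y))
      pair-conv₂-X-summand p1 p2 r1 r2 = trans (pair-∗ (⟪ p1 ⟫ ∗ ⟪ r1 ⟫) (X p2 r2) F)
        (trans (pair-⟪⟫∗⟪⟫ p1 r1 (λ x → ⟨ X p2 r2 ∣ (λ y → ∑⧢ x y F) ⟩))
        (∑⧢-cong p1 r1 (λ x → trans (pair-linExt S (⟪ p2 ⟫ ∗ ⟪ r2 ⟫) (λ y → ∑⧢ x y F)) (pair-⟪⟫∗⟪⟫ p2 r2 (λ t → G x t)))))

      ∑Δ-G-rightAntipode : ∀ w → ∑Δ w G ≡ εw w *ℚ F []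
      ∑Δ-G-rightAntipode w = trans (sym (∑-deconc w G)) (trans (∑-cong (deconc w) (λ p → sym (pair-summand p)))
        (trans (sym (pair-concatMap (λ p → ⟪ proj₁ p ⟫ ∗ S (proj₂ p)) (deconc w) F)) (trans (≈app (ra w) F) (pair-scale-𝟙 (εw w) F))))
        where
        pair-summand : ∀ (p : Word × Word) → ⟨ ⟪ proj₁ p ⟫ ∗ S (proj₂ p) ∣ F ⟩ ≡ G (proj₁ p) (proj₂ p)
        pair-summand p = trans (pair-∗ ⟪ proj₁ p ⟫ (S (proj₂ p)) F) (pair-⟪⟫ (proj₁ p) (λ x → ⟨ S (proj₂ p) ∣ (λ y → ∑⧢ x y F) ⟩))

      pair-conv₂-X : ⟨ conv₂ X u v ∣ F ⟩ ≡ ⟨ scale (εw u *ℚ εw v) 𝟙 ∣ F ⟩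
      pair-conv₂-X = trans (pair-conv₂ X u v F)
        (trans (∑Δ-cong u _ _ (λ p1 p2 → ∑Δ-cong v _ _ (λ r1 r2 → pair-conv₂-X-summand p1 p2 r1 r2)))
        (trans (sym (∑Δ-⧢ u v G))
        (trans (∑-cong (qsh u v) (λ w → trans (∑Δ-G-rightAntipode w) (ℚP.*-comm (εw w) (F []))))
        (trans (∑-*ˡ (qsh u v) (F []) εw)
        (trans (cong (F [] *ℚ_) (∑⧢-εw u v))
        (trans (ℚP.*-comm (F []) (εw u *ℚ εw v)) (sym (pair-scale-𝟙 (εw u *ℚ εw v) F))))))))

    X-isConv₂Unit : IsConv₂Unit X
    X-isConv₂Unit u v = mk≈ (pair-conv₂-X u v)

    ∗-assoc₄ : ∀ a b c d → (a ∗ b) ∗ (c ∗ d) ≈ a ∗ ((b ∗ c) ∗ d)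
    ∗-assoc₄ a b c d = ≈-trans (∗-assoc a b (c ∗ d)) (∗-congʳ a (≈-sym (∗-assoc b c d)))

    Y-isConv₂Unit : IsConv₂Unit Y
    Y-isConv₂Unit u v = begin
      conv₂ Y u v ≈⟨ concatMap-cong (deconc u) (λ p → inner (proj₁ p) (proj₂ p)) ⟩
      concatMap (λ p → scale (εw v) (⟪ proj₁ p ⟫ ∗ S (proj₂ p))) (deconc u) ≈⟨ ≈-sym (scale-concatMap (εw v) _ (deconc u)) ⟩
      scale (εw v) (concatMap (λ p → ⟪ proj₁ p ⟫ ∗ S (proj₂ p)) (deconc u)) ≈⟨ scale-cong (εw v) (ra u) ⟩
      scale (εw v) (scale (εw u) 𝟙) ≈⟨ mk≈ (λ F → trans (pair-scale (εw v) (scale (εw u) 𝟙) F) (trans (cong (εw v *ℚ_)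
          (pair-scale-𝟙 (εw u) F))
           (trans (sym (ℚP.*-assoc (εw v) (εw u) (F []))) (trans (cong (_*ℚ F []) (ℚP.*-comm (εw v) (εw u))) (sym (pair-scale-𝟙
               (εw u *ℚ εw v) F)))))) ⟩
      scale (εw u *ℚ εw v) 𝟙 ∎
      where
      inner : ∀ p1 p2 → concatMap (λ r → (⟪ p1 ⟫ ∗ ⟪ proj₁ r ⟫) ∗ Y p2 (proj₂ r)) (deconc v) ≈ scale (εw v) (⟪ p1 ⟫ ∗ S p2)
      inner p1 p2 = begin
        concatMap (λ r → (⟪ p1 ⟫ ∗ ⟪ proj₁ r ⟫) ∗ (S (proj₂ r) ∗ S p2)) (deconc v)
          ≈⟨ concatMap-cong (deconc v) (λ r → ∗-assoc₄ ⟪ p1 ⟫ ⟪ proj₁ r ⟫ (S (proj₂ r)) (S p2)) ⟩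
        concatMap (λ r → ⟪ p1 ⟫ ∗ ((⟪ proj₁ r ⟫ ∗ S (proj₂ r)) ∗ S p2)) (deconc v)
          ≈⟨ ≈-sym (∗-concatMapʳ ⟪ p1 ⟫ (λ r → (⟪ proj₁ r ⟫ ∗ S (proj₂ r)) ∗ S p2) (deconc v)) ⟩
        ⟪ p1 ⟫ ∗ concatMap (λ r → (⟪ proj₁ r ⟫ ∗ S (proj₂ r)) ∗ S p2) (deconc v)
          ≈⟨ ∗-congʳ ⟪ p1 ⟫ (≈-sym (∗-concatMapˡ (λ r → ⟪ proj₁ r ⟫ ∗ S (proj₂ r)) (deconc v) (S p2))) ⟩
        ⟪ p1 ⟫ ∗ (concatMap (λ r → ⟪ proj₁ r ⟫ ∗ S (proj₂ r)) (deconc v) ∗ S p2)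
          ≈⟨ ∗-congʳ ⟪ p1 ⟫ (∗-congˡ (S p2) (ra v)) ⟩
        ⟪ p1 ⟫ ∗ (scale (εw v) 𝟙 ∗ S p2) ≈⟨ ∗-congʳ ⟪ p1 ⟫ (≈-trans (∗-scaleˡ (εw v) 𝟙 (S p2)) (scale-cong (εw v) (∗-identityˡ (S p2)))) ⟩
        ⟪ p1 ⟫ ∗ scale (εw v) (S p2) ≈⟨ ∗-scaleʳ (εw v) ⟪ p1 ⟫ (S p2) ⟩
        scale (εw v) (⟪ p1 ⟫ ∗ S p2) ∎

    S-⟪⟫∗⟪⟫ : ∀ u v → linExt S (⟪ u ⟫ ∗ ⟪ v ⟫) ≈ S v ∗ S u
    S-⟪⟫∗⟪⟫ = conv₂-unit-unique X Y X-isConv₂Unit Y-isConv₂Unit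

    S-antimultiplicative : ∀ x y → linExt S (x ∗ y) ≈ linExt S y ∗ linExt S x
    S-antimultiplicative x y = mk≈ λ F →
      let K = λ u t → ⟨ S u ∣ (λ t' → ∑⧢ t t' F) ⟩
          H = λ u v → ⟨ S v ∣ (λ t → K u t) ⟩
      in trans (pair-linExt S (x ∗ y) F) (trans (pair-∗ x y (λ w → ⟨ S w ∣ F ⟩))
         (trans (pair-cong x (λ u → pair-cong y (λ v → step F u v)))
         (trans (pair-swap x y H) (trans (pair-cong y (λ v → pair-swap x (S v) (λ u t → K u t)))
         (sym (trans (pair-∗ (linExt S y) (linExt S x) F) (trans (pair-linExt S y _)
            (pair-cong y (λ v → pair-cong (S v) (λ t → pair-linExt S x (λ t' → ∑⧢ t t' F)))))))))))
      where
      step : ∀ F u v → ∑⧢ u v (λ w → ⟨ S w ∣ F ⟩) ≡ ⟨ S v ∣ (λ t → ⟨ S u ∣ (λ t' → ∑⧢ t t' F) ⟩) ⟩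
      step F u v = trans (sym (trans (pair-linExt S (⟪ u ⟫ ∗ ⟪ v ⟫) F) (pair-⟪⟫∗⟪⟫ u v (λ w → ⟨ S w ∣ F ⟩))))
         (trans (≈app (S-⟪⟫∗⟪⟫ u v) F) (pair-∗ (S v) (S u) F))

    linExt-concatMap : ∀ {X' : Set} (f : X' → Lin) l → linExt S (concatMap f l) ≈ concatMap (λ t → linExt S (f t)) l
    linExt-concatMap f l = mk≈ λ F → trans (pair-linExt S (concatMap f l) F) (trans (pair-concatMap f l _)
      (trans (∑-cong l (λ t → sym (pair-linExt S (f t) F))) (sym (pair-concatMap (λ t → linExt S (f t)) l F))))

    S-InN-Inℐ : ∀ n → InN n → Inℐ (linExt S n)
    S-InN-Inℐ n (n' , alln , q) = Inℐ-≈ (linExt S n') (linExt S n) (linExt-cong S n' n (≈-sym (≋→≈ {n} {n'} q)))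
      (Inℐ-concatMapAll (λ s → scale (proj₁ s) (S (proj₂ s))) (λ {s} ns → Inℐ-scale (proj₁ s) (S (proj₂ s))
          (rightAntipode-NonSingular S ra (proj₂ s) ns)) n' alln)

    S-Inℐ-closed : ∀ x → Inℐ x → Inℐ (linExt S x)
    S-Inℐ-closed x (L , allL , p) = Inℐ-≈ _ (linExt S x)
      (≈-sym (≈-trans (linExt-cong S x (idealSum L) (≋→≈ {x} {idealSum L} p)) (linExt-concatMap _ L)))
      (Inℐ-concatMapAll _ (λ {t} nn → one t nn) L allL)
      where
      one : ∀ (t : Lin × Lin × Lin) → InN (proj₁ (proj₂ t)) → Inℐ (linExt S ((proj₁ t ∗ proj₁ (proj₂ t)) ∗ proj₂ (proj₂ t)))
      one (a , n , b) nn = Inℐ-≈ (linExt S b ∗ (linExt S n ∗ linExt S a)) (linExt S ((a ∗ n) ∗ b))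
        (≈-sym (≈-trans (S-antimultiplicative (a ∗ n) b) (∗-congʳ (linExt S b) (S-antimultiplicative a n))))
        (Inℐ-∗ˡ (linExt S b) (linExt S n ∗ linExt S a) (Inℐ-∗ʳ (linExt S a) (linExt S n) (S-InN-Inℐ n nn)))

  -- An antipode of H

  -- S w = ε(w) 𝟙 − Σ_{uv = w, u ≠ []} u ∗ S v; fuel exceeding the length of w makes the recursion structural.
  antipodeFuel : ℕ → Word → Lin
  antipodeFuel zero w = []
  antipodeFuel (suc n) w = scale (εw w) 𝟙 ++ neg (concatMap (λ p → ⟪ proj₁ p ⟫ ∗ antipodeFuel n (proj₂ p)) (properDeconc w))

  antipode : Word → Lin
  antipode w = antipodeFuel (suc (length w)) w

  antipodeFuel-≈ : ∀ n m w → length w < n → length w < m → antipodeFuel n w ≈ antipodeFuel m w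
  antipodeFuel-≈ (suc n) (suc m) w (s≤s a) (s≤s b) = ++-cong (≈-refl {scale (εw w) 𝟙}) (scale-cong (-ℚ 1ℚ)
    (concatMap-congAll _ _ (properDeconc w) (All.map (λ {p} lt → ∗-congʳ ⟪ proj₁ p ⟫
       (antipodeFuel-≈ n m (proj₂ p) (ℕP.<-≤-trans lt a) (ℕP.<-≤-trans lt b))) (properDeconc-length w))))

  antipodeTail : Word → Lin
  antipodeTail w = concatMap (λ p → ⟪ proj₁ p ⟫ ∗ antipode (proj₂ p)) (properDeconc w)

  antipode-unfold : ∀ w → antipode w ≈ scale (εw w) 𝟙 ++ neg (antipodeTail w)
  antipode-unfold w = ++-cong (≈-refl {scale (εw w) 𝟙}) (scale-cong (-ℚ 1ℚ)
    (concatMap-congAll _ _ (properDeconc w) (All.map (λ {p} lt → ∗-congʳ ⟪ proj₁ p ⟫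
       (antipodeFuel-≈ (length w) (suc (length (proj₂ p))) (proj₂ p) lt ℕP.≤-refl)) (properDeconc-length w))))

  antipode-right : IsRightAntipode antipode
  antipode-right w = begin
    concatMap (λ p → ⟪ proj₁ p ⟫ ∗ antipode (proj₂ p)) (deconc w) ≡⟨ cong (concatMap (λ p → ⟪ proj₁ p ⟫ ∗ antipode (proj₂ p)))
        (deconc-properDeconc w) ⟩
    (⟪ [] ⟫ ∗ antipode w) ++ antipodeTail w ≈⟨ ++-cong (≈-trans (∗-identityˡ (antipode w)) (antipode-unfold w)) (≈-refl {antipodeTail w}) ⟩
    (scale (εw w) 𝟙 ++ neg (antipodeTail w)) ++ antipodeTail w ≈⟨ mk≈ (λ F → trans (pair-++ (scale (εw w) 𝟙 ++ neg
        (antipodeTail w)) (antipodeTail w) F)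
        (trans (cong (_+ℚ ⟨ antipodeTail w ∣ F ⟩) (trans (pair-++ (scale (εw w) 𝟙) (neg (antipodeTail w)) F) (cong (⟨ scale
            (εw w) 𝟙 ∣ F ⟩ +ℚ_) (pair-neg (antipodeTail w) F))))
        (trans (ℚP.+-assoc ⟨ scale (εw w) 𝟙 ∣ F ⟩ (-ℚ ⟨ antipodeTail w ∣ F ⟩) ⟨ antipodeTail w ∣ F ⟩)
        (trans (cong (⟨ scale (εw w) 𝟙 ∣ F ⟩ +ℚ_) (ℚP.+-inverseˡ ⟨ antipodeTail w ∣ F ⟩)) (ℚP.+-identityʳ _))))) ⟩
    scale (εw w) 𝟙 ∎

  conv : (Word → Lin) → (Word → Lin) → Word → Lin
  conv f g w = concatMap (λ p → f (proj₁ p) ∗ g (proj₂ p)) (deconc w)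

  pair-conv : ∀ f g w F → ⟨ conv f g w ∣ F ⟩ ≡ ∑Δ w (λ p s → ⟨ f p ∗ g s ∣ F ⟩)
  pair-conv f g w F = trans (pair-concatMap _ (deconc w) F) (∑-deconc w (λ p s → ⟨ f p ∗ g s ∣ F ⟩))

  conv-cong : ∀ f f' g g' → (∀ w → f w ≈ f' w) → (∀ w → g w ≈ g' w) → ∀ w → conv f g w ≈ conv f' g' w
  conv-cong f f' g g' hf hg w = concatMap-cong (deconc w) (λ p → ∗-cong (hf (proj₁ p)) (hg (proj₂ p)))

  conv-assoc : ∀ f g h w → conv (conv f g) h w ≈ conv f (conv g h) w
  conv-assoc f g h w = mk≈ λ F → trans (pair-conv (conv f g) h w F)
    (trans (∑Δ-cong w _ (λ p s → ∑Δ p (λ p1 p2 → ⟨ f p1 ∗ (g p2 ∗ h s) ∣ F ⟩)) (λ p s →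
        trans (≈app (∗-concatMapˡ (λ q → f (proj₁ q) ∗ g (proj₂ q)) (deconc p) (h s)) F)
        (trans (pair-concatMap _ (deconc p) F) (trans (∑-deconc p (λ p1 p2 → ⟨ (f p1 ∗ g p2) ∗ h s ∣ F ⟩))
        (∑Δ-cong p _ _ (λ p1 p2 → ≈app (∗-assoc (f p1) (g p2) (h s)) F))))))
    (trans (∑Δ-coassoc w (λ p1 p2 s → ⟨ f p1 ∗ (g p2 ∗ h s) ∣ F ⟩))
    (sym (trans (pair-conv f (conv g h) w F) (∑Δ-cong w _ _ (λ p s →
        trans (≈app (∗-concatMapʳ (f p) (λ q → g (proj₁ q) ∗ h (proj₂ q)) (deconc s)) F)
        (trans (pair-concatMap _ (deconc s) F) (∑-deconc s (λ s1 s2 → ⟨ f p ∗ (g s1 ∗ h s2) ∣ F ⟩)))))))))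

  η : Word → Lin
  η w = scale (εw w) 𝟙

  word : Word → Lin
  word w = ⟪ w ⟫

  conv-ηˡ : ∀ g w → conv η g w ≈ g w
  conv-ηˡ g w = mk≈ λ F → trans (pair-conv η g w F) (trans (∑Δ-cong w _ (λ p s → εw p *ℚ ⟨ g s ∣ F ⟩)
    (λ p s → trans (≈app (≈-trans (∗-scaleˡ (εw p) 𝟙 (g s)) (scale-cong (εw p) (∗-identityˡ (g s)))) F) (pair-scale (εw p) (g s) F)))
    (∑Δ-εwˡ w (λ p s → ⟨ g s ∣ F ⟩)))

  conv-ηʳ : ∀ f w → conv f η w ≈ f w
  conv-ηʳ f w = mk≈ λ F → trans (pair-conv f η w F) (trans (∑Δ-cong w _ (λ p s → ⟨ f p ∣ F ⟩ *ℚ εw s)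
    (λ p s → trans (≈app (≈-trans (∗-scaleʳ (εw s) (f p) 𝟙) (scale-cong (εw s) (∗-identityʳ (f p)))) F)
       (trans (pair-scale (εw s) (f p) F) (ℚP.*-comm (εw s) ⟨ f p ∣ F ⟩))))
    (∑Δ-εwʳ w (λ p s → ⟨ f p ∣ F ⟩)))

  initDeconc : Word → List (Word × Word)
  initDeconc [] = []
  initDeconc (a ∷ w) = ([] , a ∷ w) ∷ map (λ p → (a ∷ proj₁ p , proj₂ p)) (initDeconc w)

  deconc-initDeconc : ∀ w → deconc w ≡ initDeconc w ++ ((w , []) ∷ [])
  deconc-initDeconc [] = refl
  deconc-initDeconc (a ∷ w) = cong (([] , a ∷ w) ∷_) (trans (cong (map (λ p → (a ∷ proj₁ p , proj₂ p))) (deconc-initDeconc w))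
    (LP.map-++ (λ p → (a ∷ proj₁ p , proj₂ p)) (initDeconc w) _))

  initDeconc-length : ∀ w → All (λ p → length (proj₁ p) < length w) (initDeconc w)
  initDeconc-length [] = []
  initDeconc-length (a ∷ w) = s≤s z≤n ∷ gmap⁺ (λ lt → s≤s lt) (initDeconc-length w)

  antipode-[] : antipode [] ≈ 𝟙
  antipode-[] = mk≈ λ F → trans (pair-++ (scale 1ℚ 𝟙) (neg []) F) (trans (ℚP.+-identityʳ _) (trans (pair-scale 1ℚ 𝟙 F) (ℚP.*-identityˡ _)))

  conv-antipode-cancelʳ : ∀ X X' → (∀ w → conv X antipode w ≈ antipode w) → (∀ w → conv X' antipode w ≈ antipode w) → ∀ w → X w ≈ X' w
  conv-antipode-cancelʳ X X' hX hX' w = go (suc (length w)) w ℕP.≤-refl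
    where
    I : (Word → Lin) → Word → Lin
    I Z w = concatMap (λ p → Z (proj₁ p) ∗ antipode (proj₂ p)) (initDeconc w)
    splitL : ∀ Z w → conv Z antipode w ≈ Z w ++ I Z w
    splitL Z w = begin
      conv Z antipode w ≡⟨ cong (concatMap (λ p → Z (proj₁ p) ∗ antipode (proj₂ p))) (deconc-initDeconc w) ⟩
      concatMap (λ p → Z (proj₁ p) ∗ antipode (proj₂ p)) (initDeconc w ++ ((w , []) ∷ [])) ≈⟨ concatMap-++ _ (initDeconc w) _ ⟩
      I Z w ++ ((Z w ∗ antipode []) ++ []) ≈⟨ ++-cong (≈-refl {I Z w}) (≈-trans (++-identityʳ (Z w ∗ antipode [])) (≈-trans
          (∗-congʳ (Z w) antipode-[]) (∗-identityʳ (Z w)))) ⟩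
      I Z w ++ Z w ≈⟨ ++-comm (I Z w) (Z w) ⟩
      Z w ++ I Z w ∎
    go : ∀ n w → length w < n → X w ≈ X' w
    go zero w ()
    go (suc n) w (s≤s le) = ++-cancelʳ (X w) (X' w) (I X w) (I X' w)
      (≈-trans (≈-sym (splitL X w)) (≈-trans (hX w) (≈-trans (≈-sym (hX' w)) (splitL X' w))))
      (concatMap-congAll _ _ (initDeconc w) (All.map (λ {p} lt → ∗-congˡ (antipode (proj₂ p)) (go n (proj₁ p)
          (ℕP.<-≤-trans lt le))) (initDeconc-length w)))

  antipode-left : ∀ w → conv antipode word w ≈ η w
  antipode-left = conv-antipode-cancelʳ (conv antipode word) η hD hη
    where
    hη : ∀ w → conv η antipode w ≈ antipode w
    hη w = conv-ηˡ antipode w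
    hD : ∀ w → conv (conv antipode word) antipode w ≈ antipode w
    hD w = ≈-trans (conv-assoc antipode word antipode w) (≈-trans (conv-cong antipode antipode (conv word antipode) η
        (λ _ → ≈-refl) antipode-right w) (conv-ηʳ antipode w))

  Inℐ-isHopfIdeal : IsHopfIdeal Inℐ
  Inℐ-isHopfIdeal = record
    { respects-≋ = λ {x} {y} → Inℐ-≋ x y
    ; zero-mem = Inℐ-[]
    ; +-closed = λ {x} {y} → Inℐ-++ x y
    ; scale-closed = λ q {x} → Inℐ-scale q x
    ; ∗-closedˡ = λ h {x} → Inℐ-∗ˡ h x
    ; ∗-closedʳ = λ h {x} → Inℐ-∗ʳ h x
    ; Δ-closed = λ {x} → Inℐ-Δ-closed x
    ; ε-vanishes = λ {x} → ε-Inℐ x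
    ; S-closed = λ S isA {x} → RightAntipode.S-Inℐ-closed S (IsAntipode→IsRightAntipode S isA) x
    }

module CharacterGroup {c ℓ : Level} (A : CommutativeRing c ℓ) (ι : ℚ → CommutativeRing.Carrier A)
         (hom : RingMorphisms.IsRingHomomorphism +-*-rawRing (CommutativeRing.rawRing A) ι) where

  open CommutativeRing A renaming (_≈_ to _≈ᴬ_; refl to ≈ᴬ-refl; sym to ≈ᴬ-sym; trans to ≈ᴬ-trans)
  open RingMorphisms.IsRingHomomorphism hom using (+-homo; *-homo; 0#-homo; 1#-homo; -‿homo)
  open import Relation.Binary.Reasoning.Setoid setoid
  open import Algebra.Properties.Group +-group using (x∙y⁻¹≈ε⇒x≈y)
  open import Algebra.Properties.CommutativeSemigroup *-commutativeSemigroup using (interchange)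
  open Characters A ι

  ι-cong : ∀ {p q} → p ≡ q → ι p ≈ᴬ ι q
  ι-cong refl = ≈ᴬ-refl

  module EvalA = LinearForm A ι hom
  module EvalA¹ = EvalA Word _≟ʷ_ coeff coeff-[] coeff-yes coeff-no
  module EvalA² = EvalA (Word × Word) _≟ʷʷ_ coeff₂ (λ _ → refl) coeff₂-yes coeff₂-no

  ∑ᴬ : {X : Set} → List X → (X → Carrier) → Carrier
  ∑ᴬ l g = foldr (λ t acc → g t + acc) 0# l

  ∑ᴬ-cong : ∀ {X : Set} (l : List X) {f g : X → Carrier} → (∀ x → f x ≈ᴬ g x) → ∑ᴬ l f ≈ᴬ ∑ᴬ l g
  ∑ᴬ-cong [] h = ≈ᴬ-refl
  ∑ᴬ-cong (x ∷ l) h = +-cong (h x) (∑ᴬ-cong l h)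

  ∑ᴬ-++ : ∀ {X : Set} (l m : List X) f → ∑ᴬ (l ++ m) f ≈ᴬ ∑ᴬ l f + ∑ᴬ m f
  ∑ᴬ-++ [] m f = ≈ᴬ-sym (+-identityˡ _)
  ∑ᴬ-++ (x ∷ l) m f = ≈ᴬ-trans (+-congˡ (∑ᴬ-++ l m f)) (≈ᴬ-sym (+-assoc _ _ _))

  ∑ᴬ-map : ∀ {X Y : Set} (g : X → Y) (l : List X) f → ∑ᴬ (map g l) f ≈ᴬ ∑ᴬ l (λ x → f (g x))
  ∑ᴬ-map g [] f = ≈ᴬ-refl
  ∑ᴬ-map g (x ∷ l) f = +-congˡ (∑ᴬ-map g l f)

  ∑ᴬ-concatMap : ∀ {X Y : Set} (g : X → List Y) (l : List X) f → ∑ᴬ (concatMap g l) f ≈ᴬ ∑ᴬ l (λ x → ∑ᴬ (g x) f)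
  ∑ᴬ-concatMap g [] f = ≈ᴬ-refl
  ∑ᴬ-concatMap g (x ∷ l) f = ≈ᴬ-trans (∑ᴬ-++ (g x) (concatMap g l) f) (+-congˡ (∑ᴬ-concatMap g l f))

  ∑ᴬ-*ˡ : ∀ {X : Set} (l : List X) a f → a * ∑ᴬ l f ≈ᴬ ∑ᴬ l (λ x → a * f x)
  ∑ᴬ-*ˡ [] a f = zeroʳ a
  ∑ᴬ-*ˡ (x ∷ l) a f = ≈ᴬ-trans (distribˡ a _ _) (+-congˡ (∑ᴬ-*ˡ l a f))

  ∑ᴬ-*ʳ : ∀ {X : Set} (l : List X) a f → ∑ᴬ l f * a ≈ᴬ ∑ᴬ l (λ x → f x * a)
  ∑ᴬ-*ʳ [] a f = zeroˡ a
  ∑ᴬ-*ʳ (x ∷ l) a f = ≈ᴬ-trans (distribʳ a _ _) (+-congˡ (∑ᴬ-*ʳ l a f))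

  ∑ᴬ-zero : ∀ {X : Set} {P : X → Set} {f : X → Carrier} {l} → All P l → (∀ {t} → P t → f t ≈ᴬ 0#) → ∑ᴬ l f ≈ᴬ 0#
  ∑ᴬ-zero [] h = ≈ᴬ-refl
  ∑ᴬ-zero (p ∷ ps) h = ≈ᴬ-trans (+-cong (h p) (∑ᴬ-zero ps h)) (+-identityˡ 0#)

  lin-≋ : ∀ φ x y → x ≋ y → lin φ x ≈ᴬ lin φ y
  lin-≋ φ x y h = EvalA¹.evalLin-cf-cong φ x y h

  lin-≈ : ∀ φ x y → x ≈ y → lin φ x ≈ᴬ lin φ y
  lin-≈ φ x y p = lin-≋ φ x y (≈→≋ p)

  lin-++ : ∀ φ x y → lin φ (x ++ y) ≈ᴬ lin φ x + lin φ y
  lin-++ φ x y = EvalA¹.evalLin-++ φ x y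

  lin-cong : ∀ {φ ψ} x → (∀ w → φ w ≈ᴬ ψ w) → lin φ x ≈ᴬ lin ψ x
  lin-cong x h = ∑ᴬ-cong x (λ t → *-congˡ (h (proj₂ t)))

  lin-scale : ∀ φ q x → lin φ (scale q x) ≈ᴬ ι q * lin φ x
  lin-scale φ q [] = ≈ᴬ-sym (zeroʳ (ι q))
  lin-scale φ q ((p , u) ∷ x) = begin
    ι (q *ℚ p) * φ u + lin φ (scale q x) ≈⟨ +-cong (*-congʳ (*-homo q p)) (lin-scale φ q x) ⟩
    (ι q * ι p) * φ u + ι q * lin φ x ≈⟨ +-congʳ (*-assoc (ι q) (ι p) (φ u)) ⟩
    ι q * (ι p * φ u) + ι q * lin φ x ≈⟨ ≈ᴬ-sym (distribˡ (ι q) _ _) ⟩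
    ι q * (ι p * φ u + lin φ x) ∎

  lin-neg : ∀ φ x → lin φ (neg x) ≈ᴬ - lin φ x
  lin-neg φ x = ≈ᴬ-trans (lin-scale φ (-ℚ 1ℚ) x) (≈ᴬ-trans (*-congʳ (≈ᴬ-trans (-‿homo 1ℚ) (-‿cong 1#-homo)))
      (RingProps.-1*x≈-x ring (lin φ x)))

  lin-word : ∀ φ w → lin φ ⟪ w ⟫ ≈ᴬ φ w
  lin-word φ w = ≈ᴬ-trans (+-identityʳ _) (≈ᴬ-trans (*-congʳ 1#-homo) (*-identityˡ (φ w)))

  lin-concatMap : ∀ {X : Set} φ (f : X → Lin) l → lin φ (concatMap f l) ≈ᴬ ∑ᴬ l (λ t → lin φ (f t))
  lin-concatMap φ f l = ∑ᴬ-concatMap f l _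

  lin-linExt : ∀ φ S x → lin φ (linExt S x) ≈ᴬ lin (λ u → lin φ (S u)) x
  lin-linExt φ S x = ≈ᴬ-trans (lin-concatMap φ _ x) (∑ᴬ-cong x (λ s → lin-scale φ (proj₁ s) (S (proj₂ s))))

  lin₂ : (Word → Word → Carrier) → Lin2 → Carrier
  lin₂ G z = foldr (λ t acc → ι (proj₁ t) * G (proj₁ (proj₂ t)) (proj₂ (proj₂ t)) + acc) 0# z

  lin₂-≋ : ∀ G z z' → z ≋₂ z' → lin₂ G z ≈ᴬ lin₂ G z'
  lin₂-≋ G z z' h = EvalA².evalLin-cf-cong (λ p → G (proj₁ p) (proj₂ p)) z z' (λ k → h (proj₁ k) (proj₂ k))

  lin₂-concatMap : ∀ {X : Set} G (f : X → Lin2) l → lin₂ G (concatMap f l) ≈ᴬ ∑ᴬ l (λ t → lin₂ G (f t))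
  lin₂-concatMap G f l = ∑ᴬ-concatMap f l _

  lin₂-scale⊗ : ∀ G q x y → lin₂ G (scale q x ⊗ y) ≈ᴬ ι q * lin (λ u → lin (λ v → G u v) y) x
  lin₂-scale⊗ G q x y = begin
    lin₂ G (scale q x ⊗ y) ≈⟨ lin₂-concatMap G _ (scale q x) ⟩
    ∑ᴬ (scale q x) (λ s → lin₂ G (map (λ t → (proj₁ s *ℚ proj₁ t , proj₂ s , proj₂ t)) y)) ≈⟨ ∑ᴬ-map _ x _ ⟩
    ∑ᴬ x (λ s → lin₂ G (map (λ t → ((q *ℚ proj₁ s) *ℚ proj₁ t , proj₂ s , proj₂ t)) y))
      ≈⟨ ∑ᴬ-cong x (λ s → ≈ᴬ-trans (∑ᴬ-map _ y _) (≈ᴬ-trans (∑ᴬ-cong y (λ t →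
           ≈ᴬ-trans (*-congʳ (≈ᴬ-trans (*-homo (q *ℚ proj₁ s) (proj₁ t)) (*-congʳ (*-homo q (proj₁ s)))))
           (≈ᴬ-trans (*-assoc _ _ _) (*-assoc _ _ _)))) (≈ᴬ-sym (∑ᴬ-*ˡ y (ι q) _)))) ⟩
    ∑ᴬ x (λ s → ι q * ∑ᴬ y (λ t → ι (proj₁ s) * (ι (proj₁ t) * G (proj₂ s) (proj₂ t))))
      ≈⟨ ∑ᴬ-cong x (λ s → *-congˡ (≈ᴬ-sym (∑ᴬ-*ˡ y (ι (proj₁ s)) _))) ⟩
    ∑ᴬ x (λ s → ι q * (ι (proj₁ s) * lin (λ v → G (proj₂ s) v) y)) ≈⟨ ≈ᴬ-sym (∑ᴬ-*ˡ x (ι q) _) ⟩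
    ι q * lin (λ u → lin (λ v → G u v) y) x ∎

  lin-⋆ : ∀ φ ψ x → lin (φ ⋆ ψ) x ≈ᴬ lin₂ (λ a b → φ a * ψ b) (Δ x)
  lin-⋆ φ ψ x = ≈ᴬ-sym (≈ᴬ-trans (lin₂-concatMap _ _ x) (∑ᴬ-cong x (λ s → ≈ᴬ-trans (∑ᴬ-map _ (deconc (proj₂ s)) _)
    (≈ᴬ-sym (∑ᴬ-*ˡ (deconc (proj₂ s)) (ι (proj₁ s)) _)))))

  lin-*const : ∀ (k : Carrier) ψ x → lin (λ b → k * ψ b) x ≈ᴬ k * lin ψ x
  lin-*const k ψ x = ≈ᴬ-trans (∑ᴬ-cong x (λ t → ≈ᴬ-trans (≈ᴬ-sym (*-assoc _ _ _)) (≈ᴬ-trans (*-congʳ (*-comm _ k)) (*-assoc _ _ _))))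
    (≈ᴬ-sym (∑ᴬ-*ˡ x k _))

  lin-const* : ∀ (k : Carrier) φ x → lin (λ a → φ a * k) x ≈ᴬ lin φ x * k
  lin-const* k φ x = ≈ᴬ-trans (∑ᴬ-cong x (λ t → ≈ᴬ-sym (*-assoc _ _ _))) (≈ᴬ-sym (∑ᴬ-*ʳ x k _))

  character-[] : ∀ φ → IsCharacter φ → φ [] ≈ᴬ 1#
  character-[] φ ch = ≈ᴬ-trans (≈ᴬ-sym (lin-word φ [])) (proj₁ ch)

  character-⟪⟫∗⟪⟫ : ∀ φ → IsCharacter φ → ∀ a b → lin φ (⟪ a ⟫ ∗ ⟪ b ⟫) ≈ᴬ φ a * φ b
  character-⟪⟫∗⟪⟫ φ ch a b = ≈ᴬ-trans (proj₂ ch ⟪ a ⟫ ⟪ b ⟫) (*-cong (lin-word φ a) (lin-word φ b))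

  InT-NonSingular : ∀ φ → InT φ → ∀ w → NonSingular w → φ w ≈ᴬ 0#
  InT-NonSingular φ t w ns = ≈ᴬ-trans (≈ᴬ-sym (lin-word φ w)) (proj₂ t ⟪ w ⟫ (InN-⟪⟫ w ns))

  InT-Inℐ : ∀ φ → InT φ → ∀ x → Inℐ x → lin φ x ≈ᴬ 0#
  InT-Inℐ φ t x (L , allL , p) = ≈ᴬ-trans (lin-≋ φ x (idealSum L) p) (≈ᴬ-trans (lin-concatMap φ _ L)
    (∑ᴬ-zero allL (λ {s} nn → one s nn)))
    where
    one : ∀ (s : Lin × Lin × Lin) → InN (proj₁ (proj₂ s)) → lin φ ((proj₁ s ∗ proj₁ (proj₂ s)) ∗ proj₂ (proj₂ s)) ≈ᴬ 0#
    one (a , n , b) nn = ≈ᴬ-trans (proj₂ (proj₁ t) (a ∗ n) b) (≈ᴬ-trans (*-congʳ (≈ᴬ-trans (proj₂ (proj₁ t) a n)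
      (≈ᴬ-trans (*-congˡ (proj₂ t n nn)) (zeroʳ _)))) (zeroˡ _))

  e≈ι∘εw : ∀ w → e w ≈ᴬ ι (εw w)
  e≈ι∘εw [] = ≈ᴬ-sym 1#-homo
  e≈ι∘εw (_ ∷ _) = ≈ᴬ-sym 0#-homo

  lin-e≈ι∘ε : ∀ x → lin e x ≈ᴬ ι (ε x)
  lin-e≈ι∘ε x = ≈ᴬ-trans (go x) (ι-cong (Eq.sym (ε≡pair-εw x)))
    where
    go : ∀ x → lin e x ≈ᴬ ι ⟨ x ∣ εw ⟩
    go [] = ≈ᴬ-sym 0#-homo
    go ((q , u) ∷ x) = ≈ᴬ-trans (+-cong (*-congˡ (e≈ι∘εw u)) (go x))
      (≈ᴬ-sym (≈ᴬ-trans (+-homo (q *ℚ εw u) ⟨ x ∣ εw ⟩) (+-congʳ (*-homo q (εw u)))))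

  InT-e : InT e
  InT-e = (≈ᴬ-trans (+-identityʳ _) (≈ᴬ-trans (*-congʳ 1#-homo) (*-identityˡ 1#))
          , λ x y → ≈ᴬ-trans (lin-e≈ι∘ε (x ∗ y)) (≈ᴬ-trans (ι-cong (ε-∗ x y)) (≈ᴬ-trans (*-homo (ε x) (ε y))
              (*-cong (≈ᴬ-sym (lin-e≈ι∘ε x)) (≈ᴬ-sym (lin-e≈ι∘ε y))))))
        , λ x nn → ≈ᴬ-trans (lin-e≈ι∘ε x) (≈ᴬ-trans (ι-cong (ε-InN x nn)) 0#-homo)

  regroup₆ : ∀ k1 k2 a1 a2 b1 b2 → (k1 * k2) * ((a1 * b1) * (a2 * b2)) ≈ᴬ (k1 * (a1 * a2)) * (k2 * (b1 * b2))
  regroup₆ k1 k2 a1 a2 b1 b2 = ≈ᴬ-trans (*-congˡ (interchange a1 b1 a2 b2)) (interchange k1 k2 (a1 * a2) (b1 * b2))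

  module Convolution (φ ψ : Word → Carrier) (cφ : IsCharacter φ) (cψ : IsCharacter ψ) where
    G : Word → Word → Carrier
    G a b = φ a * ψ b

    lin₂-Δ∗Δ-summand : ∀ qs qt (p r : Word × Word) → lin₂ G (Δ∗Δ-summand (qs *ℚ qt) p r) ≈ᴬ
      (ι qs * (φ (proj₁ p) * ψ (proj₂ p))) * (ι qt * (φ (proj₁ r) * ψ (proj₂ r)))
    lin₂-Δ∗Δ-summand qs qt (p1 , p2) (r1 , r2) = begin
      lin₂ G (Δ∗Δ-summand (qs *ℚ qt) (p1 , p2) (r1 , r2)) ≈⟨ lin₂-scale⊗ G (qs *ℚ qt) (⟪ p1 ⟫ ∗ ⟪ r1 ⟫) (⟪ p2 ⟫ ∗ ⟪ r2 ⟫) ⟩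
      ι (qs *ℚ qt) * lin (λ a → lin (λ b → φ a * ψ b) (⟪ p2 ⟫ ∗ ⟪ r2 ⟫)) (⟪ p1 ⟫ ∗ ⟪ r1 ⟫)
        ≈⟨ *-cong (*-homo qs qt) (lin-cong (⟪ p1 ⟫ ∗ ⟪ r1 ⟫) (λ a → ≈ᴬ-trans (lin-*const (φ a) ψ (⟪ p2 ⟫ ∗ ⟪ r2 ⟫))
             (*-congˡ (character-⟪⟫∗⟪⟫ ψ cψ p2 r2)))) ⟩
      (ι qs * ι qt) * lin (λ a → φ a * (ψ p2 * ψ r2)) (⟪ p1 ⟫ ∗ ⟪ r1 ⟫)
        ≈⟨ *-congˡ (≈ᴬ-trans (lin-const* (ψ p2 * ψ r2) φ (⟪ p1 ⟫ ∗ ⟪ r1 ⟫)) (*-congʳ (character-⟪⟫∗⟪⟫ φ cφ p1 r1))) ⟩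
      (ι qs * ι qt) * ((φ p1 * φ r1) * (ψ p2 * ψ r2)) ≈⟨ regroup₆ (ι qs) (ι qt) (φ p1) (ψ p2) (φ r1) (ψ r2) ⟩
      (ι qs * (φ p1 * ψ p2)) * (ι qt * (φ r1 * ψ r2)) ∎

    ⋆-multiplicative : ∀ x y → lin (φ ⋆ ψ) (x ∗ y) ≈ᴬ lin (φ ⋆ ψ) x * lin (φ ⋆ ψ) y
    ⋆-multiplicative x y = begin
      lin (φ ⋆ ψ) (x ∗ y) ≈⟨ lin-⋆ φ ψ (x ∗ y) ⟩
      lin₂ G (Δ (x ∗ y)) ≈⟨ lin₂-≋ G (Δ (x ∗ y)) (Δ∗Δ x y) (≈₂→≋₂ (Δ-∗ x y)) ⟩
      lin₂ G (Δ∗Δ x y) ≈⟨ ≈ᴬ-trans (lin₂-concatMap G _ x) (∑ᴬ-cong x (λ s → ≈ᴬ-trans (lin₂-concatMap G _ (deconc (proj₂ s)))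
           (∑ᴬ-cong (deconc (proj₂ s)) (λ p → ≈ᴬ-trans (lin₂-concatMap G _ y) (∑ᴬ-cong y (λ t →
             ≈ᴬ-trans (lin₂-concatMap G _ (deconc (proj₂ t))) (∑ᴬ-cong (deconc (proj₂ t)) (λ r → lin₂-Δ∗Δ-summand (proj₁ s) (proj₁ t) p r)))))))) ⟩
      ∑ᴬ x (λ s → ∑ᴬ (deconc (proj₂ s)) (λ p → ∑ᴬ y (λ t → ∑ᴬ (deconc (proj₂ t)) (λ r →
        (ι (proj₁ s) * (φ (proj₁ p) * ψ (proj₂ p))) * (ι (proj₁ t) * (φ (proj₁ r) * ψ (proj₂ r)))))))
        ≈⟨ ∑ᴬ-cong x (λ s → ∑ᴬ-cong (deconc (proj₂ s)) (λ p → ≈ᴬ-trans (∑ᴬ-cong y (λ t →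
             ≈ᴬ-trans (≈ᴬ-sym (∑ᴬ-*ˡ (deconc (proj₂ t)) _ _)) (*-congˡ (≈ᴬ-sym (∑ᴬ-*ˡ (deconc (proj₂ t)) (ι (proj₁ t)) _)))))
             (≈ᴬ-sym (∑ᴬ-*ˡ y _ _)))) ⟩
      ∑ᴬ x (λ s → ∑ᴬ (deconc (proj₂ s)) (λ p → (ι (proj₁ s) * (φ (proj₁ p) * ψ (proj₂ p))) * lin (φ ⋆ ψ) y))
        ≈⟨ ∑ᴬ-cong x (λ s → ≈ᴬ-trans (≈ᴬ-sym (∑ᴬ-*ʳ (deconc (proj₂ s)) _ _)) (*-congʳ (≈ᴬ-sym (∑ᴬ-*ˡ (deconc (proj₂ s)) _ _)))) ⟩
      ∑ᴬ x (λ s → (ι (proj₁ s) * (φ ⋆ ψ) (proj₂ s)) * lin (φ ⋆ ψ) y) ≈⟨ ≈ᴬ-sym (∑ᴬ-*ʳ x _ _) ⟩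
      lin (φ ⋆ ψ) x * lin (φ ⋆ ψ) y ∎

  ⋆-NonSingular : ∀ φ ψ → InT φ → InT ψ → ∀ w → NonSingular w → (φ ⋆ ψ) w ≈ᴬ 0#
  ⋆-NonSingular φ ψ tφ tψ (k ∷ w) ns = begin
    φ [] * ψ (k ∷ w) + ∑ᴬ (map (λ p → (k ∷ proj₁ p , proj₂ p)) (deconc w)) (λ p → φ (proj₁ p) * ψ (proj₂ p))
      ≈⟨ +-cong (*-congˡ (InT-NonSingular ψ tψ (k ∷ w) ns)) (∑ᴬ-map _ (deconc w) _) ⟩
    φ [] * 0# + ∑ᴬ (deconc w) (λ p → φ (k ∷ proj₁ p) * ψ (proj₂ p))
      ≈⟨ +-cong (zeroʳ (φ [])) (∑ᴬ-zero (deconc-All w) (λ {p} eq → ≈ᴬ-trans (*-congʳ (InT-NonSingular φ tφ (k ∷ proj₁ p)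
           (NonSingular-prefix k (proj₁ p) (proj₂ p) (Eq.subst (λ z → NonSingular (k ∷ z)) (Eq.sym eq) ns)))) (zeroˡ _))) ⟩
    0# + 0# ≈⟨ +-identityˡ 0# ⟩
    0# ∎

  InT-⋆ : ∀ φ ψ → InT φ → InT ψ → InT (φ ⋆ ψ)
  InT-⋆ φ ψ tφ tψ = (unit , Convolution.⋆-multiplicative φ ψ (proj₁ tφ) (proj₁ tψ)) , van
    where
    unit : lin (φ ⋆ ψ) 𝟙 ≈ᴬ 1#
    unit = ≈ᴬ-trans (lin-word (φ ⋆ ψ) []) (≈ᴬ-trans (+-identityʳ _) (≈ᴬ-trans (*-cong (character-[] φ (proj₁ tφ)) (character-[] ψ
        (proj₁ tψ)))
      (*-identityˡ 1#)))
    van : ∀ x → InN x → lin (φ ⋆ ψ) x ≈ᴬ 0#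
    van x (L , allL , p) = ≈ᴬ-trans (lin-≋ (φ ⋆ ψ) x L p) (∑ᴬ-zero allL (λ {t} ns →
      ≈ᴬ-trans (*-congˡ (⋆-NonSingular φ ψ tφ tψ (proj₂ t) ns)) (zeroʳ _)))

  module Inverse (φ : Word → Carrier) (tφ : InT φ) where
    open RightAntipode antipode antipode-right using (S-antimultiplicative; S-Inℐ-closed)
    ψ : Word → Carrier
    ψ w = lin φ (antipode w)

    lin-ψ : ∀ x → lin ψ x ≈ᴬ lin φ (linExt antipode x)
    lin-ψ x = ≈ᴬ-sym (lin-linExt φ antipode x)

    InT-ψ : InT ψ
    InT-ψ = (≈ᴬ-trans (lin-ψ 𝟙) (≈ᴬ-trans (lin-≈ φ (linExt antipode 𝟙) 𝟙 (≈-trans (linExt-word antipode []) antipode-[])) (proj₁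
        (proj₁ tφ)))
            , λ x y → ≈ᴬ-trans (lin-ψ (x ∗ y)) (≈ᴬ-trans (lin-≈ φ _ _ (S-antimultiplicative x y)) (≈ᴬ-trans (proj₂ (proj₁ tφ)
                (linExt antipode y) (linExt antipode x))
                (≈ᴬ-trans (*-comm _ _) (*-cong (≈ᴬ-sym (lin-ψ x)) (≈ᴬ-sym (lin-ψ y)))))))
          , λ x nn → ≈ᴬ-trans (lin-ψ x) (InT-Inℐ φ tφ (linExt antipode x) (S-Inℐ-closed x (InN→Inℐ x nn)))

    lin-η : ∀ w → lin φ (η w) ≈ᴬ e w
    lin-η w = ≈ᴬ-trans (lin-scale φ (εw w) 𝟙) (≈ᴬ-trans (*-congˡ (proj₁ (proj₁ tφ))) (≈ᴬ-trans (*-identityʳ _) (≈ᴬ-sym (e≈ι∘εw w))))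

    φ⋆ψ≐e : (φ ⋆ ψ) ≐ e
    φ⋆ψ≐e w = begin
      ∑ᴬ (deconc w) (λ p → φ (proj₁ p) * ψ (proj₂ p))
        ≈⟨ ∑ᴬ-cong (deconc w) (λ p → ≈ᴬ-sym (≈ᴬ-trans (proj₂ (proj₁ tφ) ⟪ proj₁ p ⟫ (antipode (proj₂ p))) (*-congʳ (lin-word φ
            (proj₁ p))))) ⟩
      ∑ᴬ (deconc w) (λ p → lin φ (⟪ proj₁ p ⟫ ∗ antipode (proj₂ p))) ≈⟨ ≈ᴬ-sym (lin-concatMap φ _ (deconc w)) ⟩
      lin φ (conv word antipode w) ≈⟨ lin-≈ φ _ _ (antipode-right w) ⟩
      lin φ (η w) ≈⟨ lin-η w ⟩
      e w ∎

    ψ⋆φ≐e : (ψ ⋆ φ) ≐ e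
    ψ⋆φ≐e w = begin
      ∑ᴬ (deconc w) (λ p → ψ (proj₁ p) * φ (proj₂ p))
        ≈⟨ ∑ᴬ-cong (deconc w) (λ p → ≈ᴬ-sym (≈ᴬ-trans (proj₂ (proj₁ tφ) (antipode (proj₁ p)) ⟪ proj₂ p ⟫) (*-congˡ (lin-word φ
            (proj₂ p))))) ⟩
      ∑ᴬ (deconc w) (λ p → lin φ (antipode (proj₁ p) ∗ ⟪ proj₂ p ⟫)) ≈⟨ ≈ᴬ-sym (lin-concatMap φ _ (deconc w)) ⟩
      lin φ (conv antipode word w) ≈⟨ lin-≈ φ _ _ (antipode-left w) ⟩
      lin φ (η w) ≈⟨ lin-η w ⟩
      e w ∎

  IsQuotCharacter-lin : ∀ φ → InT φ → IsQuotCharacter (lin φ)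
  IsQuotCharacter-lin φ tφ = (λ x y i → x∙y⁻¹≈ε⇒x≈y (lin φ x) (lin φ y) (≈ᴬ-trans (+-congˡ (≈ᴬ-sym (lin-neg φ y)))
                   (≈ᴬ-trans (≈ᴬ-sym (lin-++ φ x (neg y))) (InT-Inℐ φ tφ (x ++ neg y) i))))
              , ((λ x y → lin-++ φ x y)
              , ((λ q x → lin-scale φ q x)
              , (proj₁ (proj₁ tφ)
              , proj₂ (proj₁ tφ))))

  quotCharacter-[] : ∀ χ → IsQuotCharacter χ → χ [] ≈ᴬ 0#
  quotCharacter-[] χ qc = begin
    χ (scale 0ℚ [])  ≈⟨ proj₁ (proj₂ (proj₂ qc)) 0ℚ [] ⟩
    ι 0ℚ * χ []      ≈⟨ *-congʳ 0#-homo ⟩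
    0# * χ []        ≈⟨ zeroˡ (χ []) ⟩
    0#               ∎

  lin-restrict : ∀ χ → IsQuotCharacter χ → ∀ x → lin (λ w → χ ⟪ w ⟫) x ≈ᴬ χ x
  lin-restrict χ qc = go
    where
    add : ∀ x y → χ (x ++ y) ≈ᴬ χ x + χ y
    add = proj₁ (proj₂ qc)
    scl : ∀ q x → χ (scale q x) ≈ᴬ ι q * χ x
    scl = proj₁ (proj₂ (proj₂ qc))
    go : ∀ x → lin (λ w → χ ⟪ w ⟫) x ≈ᴬ χ x
    go [] = ≈ᴬ-sym (quotCharacter-[] χ qc)
    go ((q , w) ∷ x) = ≈ᴬ-trans (+-cong (≈ᴬ-sym (scl q ⟪ w ⟫)) (go x))
      (≈ᴬ-trans (≈ᴬ-sym (add (scale q ⟪ w ⟫) x)) (reflexive (cong (λ z → χ ((z , w) ∷ x)) (ℚP.*-identityʳ q))))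

  InT-restrict : ∀ χ → IsQuotCharacter χ → InT (λ w → χ ⟪ w ⟫)
  InT-restrict χ qc = (≈ᴬ-trans (lin-restrict χ qc 𝟙) (proj₁ (proj₂ (proj₂ (proj₂ qc))))
               , λ x y → ≈ᴬ-trans (lin-restrict χ qc (x ∗ y)) (≈ᴬ-trans (proj₂ (proj₂ (proj₂ (proj₂ qc))) x y)
                   (*-cong (≈ᴬ-sym (lin-restrict χ qc x)) (≈ᴬ-sym (lin-restrict χ qc y)))))
             , λ x nn → ≈ᴬ-trans (lin-restrict χ qc x) (≈ᴬ-trans (proj₁ qc x [] (Inℐ-≋ x (x ++ []) (≈→≋ (≈-sym (++-identityʳ x)))
                 (InN→Inℐ x nn)))
                 (quotCharacter-[] χ qc))

  characterGroupIso : TGroupIsoQuotChars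
  characterGroupIso = (InT-e , (InT-⋆ , (λ φ tφ → Inverse.ψ φ tφ , (Inverse.InT-ψ φ tφ , (Inverse.φ⋆ψ≐e φ tφ , Inverse.ψ⋆φ≐e φ tφ)))))
          , (lin , ((λ χ w → χ ⟪ w ⟫) , (IsQuotCharacter-lin , (InT-restrict , (Φresp , (Ψresp , (ΨΦ , (ΦΨ , homo))))))))
    where
    Φresp : ∀ φ φ' → InT φ → InT φ' → φ ≐ φ' → lin φ ≐̄ lin φ'
    Φresp φ φ' _ _ h x = lin-cong x h
    Ψresp : ∀ χ χ' → IsQuotCharacter χ → IsQuotCharacter χ' → χ ≐̄ χ' → (λ w → χ ⟪ w ⟫) ≐ (λ w → χ' ⟪ w ⟫)
    Ψresp χ χ' _ _ h w = h ⟪ w ⟫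
    ΨΦ : ∀ φ → InT φ → (λ w → lin φ ⟪ w ⟫) ≐ φ
    ΨΦ φ _ w = lin-word φ w
    ΦΨ : ∀ χ → IsQuotCharacter χ → lin (λ w → χ ⟪ w ⟫) ≐̄ χ
    ΦΨ χ qc x = lin-restrict χ qc x
    homo : ∀ φ ψ → InT φ → InT ψ → lin (φ ⋆ ψ) ≐̄ (lin φ ⋆̄ lin ψ)
    homo φ ψ _ _ x = ≈ᴬ-trans (lin-⋆ φ ψ x) (∑ᴬ-cong (Δ x) (λ t → *-congˡ
      (≈ᴬ-sym (*-cong (lin-word φ (proj₁ (proj₂ t))) (lin-word ψ (proj₂ (proj₂ t)))))))

proposition5p1 : ∀ {c ℓ : Level} → IsHopfIdeal Inℐ
    × (∀ (A : CommutativeRing c ℓ) (ι : ℚ → CommutativeRing.Carrier A)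
    → RingMorphisms.IsRingHomomorphism +-*-rawRing (CommutativeRing.rawRing A) ι
    → Characters.TGroupIsoQuotChars A ι)
proposition5p1 = Inℐ-isHopfIdeal , λ A ι hom → CharacterGroup.characterGroupIso A ι hom
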